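{- Let $D$ be a rooted dag, let $\alpha\ge1$, and consider an execution of MaxLeaves-12MIS on $D$ whose subroutine $\mathcal{A}$ is an $\alpha$-approximation algorithm for wMIS on weighted $\{2,3\}$-intersection graphs. Let $F_1$ be the branching of step (1), let $I$ be the independent set returned by $\mathcal{A}$, let $F_2$ be obtained from $F_1$ by adding, for each $x\in I$ with $w_x=2$ and underlying node $v$, the arcs $\{vu:u\in U_x\}$, and let $F_3$ be obtained from $F_1$ by adding these arcs for every $x\in I$. For $i=1,2,3$ let $k_i$ be the number of non-trivial components (components with at least one arc) of $F_i$ and $N_i$ the total number of nodes in them. Then $$\mathrm{opt}(D)\ \le\ \frac{3-2\alpha}{3}(N_1-k_1)+\frac{\alpha}{6}(N_2-k_2)+\frac{\alpha}{2}(N_3-k_3)+1,$$ where $\mathrm{opt}(D)$ is the maximum number of leaves of a spanning arborescence of $D$.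
   Context: Digraphs: a node $r$ of a digraph $D$ is a root if $D$ has a directed path from $r$ to every node; $D$ is rooted if it has a root. A dag is a digraph with no directed cycle. An arborescence is an $r$-rooted digraph with a unique directed path from $r$ to every node. A branching is a collection of vertex-disjoint arborescences; spanning if it contains every node. A leaf is a node of out-degree 0. Weighted $\{2,3\}$-intersection graphs: a hereditary $\{2,3\}$-collection is $(V,U)$ with $V$ finite, $U=\{U_v:v\in V\}$ sets of size 2 or 3, such that for each $v$ with $U_v=\{a,b,c\}$ there are $v_a,v_b,v_c\in V$ with $U_{v_a}=\{b,c\},U_{v_b}=\{a,c\},U_{v_c}=\{a,b\}$; its weighted intersection graph is the multigraph on $V$ with $|U_x\cap U_y|$ parallel edges between distinct $x,y$, weights $w_v=|U_v|-1$. wMIS: find an independent set of maximum total weight. An $\alpha$-approximation algorithm for wMIS runs in polynomial time and returns an independent set of weight at least $1/\alpha$ times the maximum. GreedyExpand$(D,t,F)$: set $F'\leftarrow F$; go through the nodes $v$ in arbitrary order; for each $v$ with out-degree 0 in the current $F'$, let $A_v$ be the arcs $vu$ of $D$ with $u$ of in-degree 0 in $F'$; if $|A_v|\ge t$ add $A_v$ to $F'$. Return $F'$. MaxLeaves-12MIS$(D)$ with subroutine $\mathcal{A}$: (1) $F_1$ := GreedyExpand$(D,4,F_0)$ where $F_0$ is the spanning branching with no arcs. (2) For each node $v$ with out-degree 0 in $F_1$, $U_v$ := nodes $u$ with in-degree 0 in $F_1$ and $vu\in A(D)$. (3) Candidates := nodes $v$ with out-degree 0 in $F_1$ and $2\le|U_v|\le3$;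 for each such $v$ with $|U_v|=3$ and each $u\in U_v$ add a new element $v_u$ with $U_{v_u}=U_v\setminus\{u\}$ and underlying node $v$ (nodes are their own underlying node). (4) $G$ := intersection multigraph on Candidates with weights $w_x=|U_x|-1$ (a weighted $\{2,3\}$-intersection graph). (5) $I$ := $\mathcal{A}(G,w)$. (6) Add to $F_1$, for each $x\in I$ with underlying node $v$, the arcs $\{vu:u\in U_x\}$. (7) Return GreedyExpand$(D,1,\cdot)$ applied to the branching of step (6).
   Formalization: The approximation ratio $\alpha\ge1$ of the subroutine for wMIS is rational. -}

module Defs where

open import Data.Bool using (Bool; true; false; _∧_; _∨_; not; if_then_else_)
open import Data.Nat using (ℕ; zero; suc; _∸_; _≤ᵇ_; _≡ᵇ_)
open import Data.Fin using (Fin; toℕ)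
open import Data.Fin.Properties using () renaming (_≟_ to _≟ᶠ_)
open import Data.List using (List; []; _∷_; length; map; filterᵇ; allFin; foldl; concatMap; lookup)
open import Data.Bool.ListAction using (all; any)
open import Data.Nat.ListAction using (sum)
open import Data.List.Relation.Unary.Unique.Propositional using (Unique)
open import Data.Product using (Σ; _×_; _,_; proj₁; proj₂; ∃)
open import Relation.Binary.PropositionalEquality using (_≡_)
open import Relation.Nullary using (¬_)
open import Relation.Nullary.Decidable using (⌊_⌋)
open import Data.Rational using (ℚ; _/_; _+_; _-_; _*_)
open import Data.Integer using (+_)

-- A digraph D has arc uv iff D u v ≡ true.  Sub-digraphs (branchings,
-- arborescences) on the same node set are given the same way.

Digraph : ℕ → Set
Digraph n = Fin n → Fin n → Bool

_==_ : ∀ {n} → Fin n → Fin n → Bool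
a == b = ⌊ a ≟ᶠ b ⌋

count : ∀ {n} → (Fin n → Bool) → ℕ
count {n} p = length (filterᵇ p (allFin n))

_⊆ᴬ_ : ∀ {n} → Digraph n → Digraph n → Set
A ⊆ᴬ B = ∀ u v → A u v ≡ true → B u v ≡ true

data Walk {n} (A : Digraph n) : Fin n → Fin n → List (Fin n) → Set where
  here : ∀ {v} → Walk A v v (v ∷ [])
  step : ∀ {u w v xs} → A u w ≡ true → Walk A w v xs → Walk A u v (u ∷ xs)

DirPath : ∀ {n} → Digraph n → Fin n → Fin n → List (Fin n) → Set
DirPath A u v xs = Walk A u v xs × Unique xs

IsDag : ∀ {n} → Digraph n → Set
IsDag A = ∀ u w xs → A u w ≡ true → ¬ DirPath A w u xs

IsRoot : ∀ {n} → Digraph n → Fin n → Set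
IsRoot A r = ∀ v → ∃ λ xs → DirPath A r v xs

IsRooted : ∀ {n} → Digraph n → Set
IsRooted {n} A = Σ (Fin n) (IsRoot A)

IsArborescence : ∀ {n} → Digraph n → Fin n → Set
IsArborescence A r =
  ∀ v → (∃ λ xs → DirPath A r v xs) ×
        (∀ xs ys → DirPath A r v xs → DirPath A r v ys → xs ≡ ys)

IsSpanningArborescenceOf : ∀ {n} → Digraph n → Digraph n → Set
IsSpanningArborescenceOf {n} D T = T ⊆ᴬ D × Σ (Fin n) (IsArborescence T)

outdeg0 : ∀ {n} → Digraph n → Fin n → Bool
outdeg0 {n} F v = all (λ u → not (F v u)) (allFin n)

indeg0 : ∀ {n} → Digraph n → Fin n → Bool
indeg0 {n} F u = all (λ w → not (F w u)) (allFin n)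

leaves : ∀ {n} → Digraph n → ℕ
leaves F = count (outdeg0 F)

-- GreedyExpand(D, t, F), with the "arbitrary order" given as a list.

Aset : ∀ {n} → Digraph n → Digraph n → Fin n → Fin n → Bool
Aset D F v u = D v u ∧ indeg0 F u

greedyStep : ∀ {n} → Digraph n → ℕ → Digraph n → Fin n → Digraph n
greedyStep D t F v =
  if outdeg0 F v ∧ (t ≤ᵇ count (Aset D F v))
  then (λ a b → F a b ∨ ((a == v) ∧ Aset D F v b))
  else F

GreedyExpand : ∀ {n} → Digraph n → ℕ → Digraph n → List (Fin n) → Digraph n
GreedyExpand D t F order = foldl (greedyStep D t) F order

F₀ : ∀ {n} → Digraph n
F₀ _ _ = false

-- U_v (meaningful for v of out-degree 0 in F₁)
Uset : ∀ {n} → Digraph n → Digraph n → Fin n → Fin n → Bool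
Uset D F₁ v u = indeg0 F₁ u ∧ D v u

-- a candidate: underlying node together with its set U_x
Cand : ℕ → Set
Cand n = Fin n × (Fin n → Bool)

candidatesOf : ∀ {n} → Digraph n → Digraph n → Fin n → List (Cand n)
candidatesOf {n} D F₁ v =
  if outdeg0 F₁ v ∧ (2 ≤ᵇ s) ∧ (s ≤ᵇ 3)
  then (v , U) ∷ (if s ≡ᵇ 3
                  then map (λ u → (v , λ x → U x ∧ not (x == u)))
                           (filterᵇ U (allFin n))
                  else [])
  else []
  where
  U = Uset D F₁ v
  s = count U

-- the vertex list of G (elements indexed by positions in this list)
Candidates : ∀ {n} → Digraph n → Digraph n → List (Cand n)
Candidates {n} D F₁ = concatMap (candidatesOf D F₁) (allFin n)

VSubset : ∀ {n} → List (Cand n) → Set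
VSubset cs = Fin (length cs) → Bool

Uof : ∀ {n} (cs : List (Cand n)) → Fin (length cs) → Fin n → Bool
Uof cs x = proj₂ (lookup cs x)

nodeOf : ∀ {n} (cs : List (Cand n)) → Fin (length cs) → Fin n
nodeOf cs x = proj₁ (lookup cs x)

weight : ∀ {n} (cs : List (Cand n)) → Fin (length cs) → ℕ
weight cs x = count (Uof cs x) ∸ 1

-- independent in the intersection multigraph: distinct members have
-- no parallel edge, i.e. |U_x ∩ U_y| = 0
Independent : ∀ {n} (cs : List (Cand n)) → VSubset cs → Set
Independent cs S = ∀ x y → ¬ (x ≡ y) → S x ≡ true → S y ≡ true →
                   count (λ z → Uof cs x z ∧ Uof cs y z) ≡ 0

totalWeight : ∀ {n} (cs : List (Cand n)) → VSubset cs → ℕ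
totalWeight cs S =
  sum (map (λ x → if S x then weight cs x else 0) (allFin (length cs)))

addArcs : ∀ {n} (cs : List (Cand n)) → Digraph n → VSubset cs →
          (Fin (length cs) → Bool) → Digraph n
addArcs cs F S sel a b =
  F a b ∨ any (λ x → S x ∧ sel x ∧ (nodeOf cs x == a) ∧ Uof cs x b)
              (allFin (length cs))

adjU : ∀ {n} → Digraph n → Fin n → Fin n → Bool
adjU F a b = F a b ∨ F b a

reachU : ∀ {n} → Digraph n → ℕ → Fin n → Fin n → Bool
reachU F zero a b = a == b
reachU {n} F (suc k) a b =
  reachU F k a b ∨ any (λ c → reachU F k a c ∧ adjU F c b) (allFin n)

sameComp : ∀ {n} → Digraph n → Fin n → Fin n → Bool
sameComp {n} F = reachU F n

inNontrivComp : ∀ {n} → Digraph n → Fin n → Bool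
inNontrivComp {n} F a =
  any (λ b → sameComp F a b ∧ any (λ c → F b c) (allFin n)) (allFin n)

Nnodes : ∀ {n} → Digraph n → ℕ
Nnodes F = count (inNontrivComp F)

-- k: number of non-trivial components (each counted via its least node)
Kcomps : ∀ {n} → Digraph n → ℕ
Kcomps {n} F = count (λ a → inNontrivComp F a ∧
  all (λ b → not (sameComp F a b) ∨ (toℕ a ≤ᵇ toℕ b)) (allFin n))

ℕ→ℚ : ℕ → ℚ
ℕ→ℚ k = + k / 1

{-# OPTIONS --safe #-}
module Submission where

-- In a branching F every non-root node has exactly one in-arc and every nontrivial component has
-- exactly one root, so N(F) − k(F) is the number of non-roots of F.  Fix a spanning arborescence T.
-- Every root of F₁ other than the root of T has a T-parent; a T-node p with c ≥ 2 such children has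
-- out-degree 0 in F₁ (GreedyExpand(4) leaves no D-successor of an expanded node uncovered) and at
-- most 3 uncovered successors, so these children form a candidate of weight c − 1.  One candidate per
-- node gives an independent set J, and counting yields leaves(T) ≤ m₁ + 1 + w(J) ≤ m₁ + 1 + α w(I),
-- where m₁ is the number of non-roots of F₁.  Conversely the sets U_x (x ∈ I) are disjoint sets of
-- roots of F₁, so adding their arcs creates Σ |U_x| new non-roots, and 6 w_x ≤ [w_x = 2] |U_x| + 3 |U_x|
-- because |U_x| ∈ {2, 3}.  Hence 4 m₁ + 6 w(I) ≤ m₂ + 3 m₃, which is exactly what the coefficients
-- (3 − 2α)/3, α/6 and α/2 need.

open import Defs

module Combinatorics where
  import Data.Nat.Properties
  open import Algebra.Properties.Semiring.Sum Data.Nat.Properties.+-*-semiring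
    using (sum; sum-syntax; sum-cong-≗; sum-replicate-zero; ∑-comm; ∑-distrib-+; *-distribˡ-sum)
  open import Data.Bool using (Bool; true; false; _∧_; _∨_; _xor_; not; if_then_else_; T; T?)
  open import Data.Bool.ListAction using (all; any)
  open import Data.Bool.Properties using (T-≡; ∧-identityʳ; ∧-zeroʳ; ∧-comm) renaming (_≟_ to _≟ᵇ_)
  open import Data.Empty using (⊥; ⊥-elim)
  open import Data.Fin using (Fin; toℕ) renaming (zero to fzero; suc to fsuc)
  open import Data.Fin.Properties using (toℕ-injective; pigeonhole) renaming (_≟_ to _≟ᶠ_)
  open import Data.List using (List; []; _∷_; _++_; length; map; filterᵇ; allFin; tabulate; lookup)
  import Data.List.Membership.DecPropositional as DecMembership
  open import Data.List.Membership.Propositional using (_∈_; _∉_; lose)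
  open import Data.List.Membership.Propositional.Properties
    using (∈-allFin; ∈-lookup; ∈-map⁺; ∈-map⁻; ∈-filter⁺; ∈-concatMap⁺; ∈-concatMap⁻)
  open import Data.List.Properties using (∷ʳ-injective)
  open import Data.List.Relation.Binary.Permutation.Propositional using (_↭_; ↭-sym)
  open import Data.List.Relation.Binary.Permutation.Propositional.Properties using (∈-resp-↭)
  open import Data.List.Relation.Unary.All using ([]; _∷_) renaming (lookup to All-lookup; tabulate to All-tabulate)
  open import Data.List.Relation.Unary.All.Properties using (all⁺; all⁻; ¬Any⇒All¬) renaming (++⁺ to All++⁺)
  open import Data.List.Relation.Unary.AllPairs using ([]; _∷_)
  open import Data.List.Relation.Unary.Any using (here; there; satisfied; index)
  open import Data.List.Relation.Unary.Any.Properties using (any⁺; any⁻; lookup-index)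
  open import Data.List.Relation.Unary.Unique.Propositional using (Unique)
  open import Data.Nat using (ℕ; zero; suc; _+_; _*_; _∸_; _≤_; _<_; _≤?_; _≤ᵇ_; _≡ᵇ_; z≤n; s≤s; s≤s⁻¹)
  import Data.Nat.ListAction as List
  open import Data.Nat.Properties
  open import Data.Nat.Solver using (module +-*-Solver)
  open import Data.Product using (_×_; _,_; proj₁; proj₂; ∃)
  open import Data.Sum using (_⊎_; inj₁; inj₂)
  open import Function using (_∘_; Equivalence)
  open import Relation.Binary.PropositionalEquality
  open import Relation.Nullary using (¬_; yes; no)

  private variable
    n : ℕ

  T⇒true : ∀ {b} → T b → b ≡ true
  T⇒true = Equivalence.to T-≡

  true⇒T : ∀ {b} → b ≡ true → T b
  true⇒T = Equivalence.from T-≡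

  ∧-true⁻ : ∀ {a b} → a ∧ b ≡ true → a ≡ true × b ≡ true
  ∧-true⁻ {true} {true} _ = refl , refl

  ∧-true⁺ : ∀ {a b} → a ≡ true → b ≡ true → a ∧ b ≡ true
  ∧-true⁺ refl refl = refl

  ∨-true⁻ : ∀ {a b} → a ∨ b ≡ true → a ≡ true ⊎ b ≡ true
  ∨-true⁻ {true} _ = inj₁ refl
  ∨-true⁻ {false} h = inj₂ h

  ∨-trueˡ : ∀ {a} b → a ≡ true → a ∨ b ≡ true
  ∨-trueˡ b refl = refl

  ∨-trueʳ : ∀ a {b} → b ≡ true → a ∨ b ≡ true
  ∨-trueʳ true _ = refl
  ∨-trueʳ false h = h

  not-true⁻ : ∀ {a} → not a ≡ true → a ≡ false
  not-true⁻ {false} _ = refl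

  true≢false : ∀ {a} → a ≡ true → a ≡ false → ⊥
  true≢false refl ()

  ≢true⇒≡false : ∀ {a} → ¬ a ≡ true → a ≡ false
  ≢true⇒≡false {true} a≢true = ⊥-elim (a≢true refl)
  ≢true⇒≡false {false} _ = refl

  ≢false⇒≡true : ∀ {a} → ¬ a ≡ false → a ≡ true
  ≢false⇒≡true {true} _ = refl
  ≢false⇒≡true {false} a≢false = ⊥-elim (a≢false refl)

  xnor⇒≡ : ∀ {a b} → not (a xor b) ≡ true → a ≡ b
  xnor⇒≡ {true} {true} _ = refl
  xnor⇒≡ {false} {false} _ = refl

  ≡⇒xnor : ∀ {a b} → a ≡ b → not (a xor b) ≡ true
  ≡⇒xnor {true} refl = refl
  ≡⇒xnor {false} refl = refl

  true⇔⇒≡ : ∀ {a b} → (a ≡ true → b ≡ true) → (b ≡ true → a ≡ true) → a ≡ b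
  true⇔⇒≡ {true} a⇒b _ = sym (a⇒b refl)
  true⇔⇒≡ {false} {true} _ b⇒a = b⇒a refl
  true⇔⇒≡ {false} {false} _ _ = refl

  ==⇒≡ : ∀ {a b : Fin n} → a == b ≡ true → a ≡ b
  ==⇒≡ {a = a} {b} h with a ≟ᶠ b
  ... | yes a≡b = a≡b

  ==-refl : ∀ (a : Fin n) → a == a ≡ true
  ==-refl a with a ≟ᶠ a
  ... | yes _ = refl
  ... | no a≢a = ⊥-elim (a≢a refl)

  ==-fsuc : ∀ (a b : Fin n) → fsuc a == fsuc b ≡ a == b
  ==-fsuc a b with a ≟ᶠ b
  ... | yes refl = refl
  ... | no _ = refl

  all-allFin⁻ : ∀ (p : Fin n → Bool) → all p (allFin n) ≡ true → ∀ i → p i ≡ true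
  all-allFin⁻ p h i = T⇒true (All-lookup (all⁺ p _ (true⇒T h)) (∈-allFin i))

  all-allFin⁺ : ∀ (p : Fin n → Bool) → (∀ i → p i ≡ true) → all p (allFin n) ≡ true
  all-allFin⁺ p h = T⇒true (all⁻ p {allFin _} (All-tabulate (λ {i} _ → true⇒T (h i))))

  any-allFin⁻ : ∀ (p : Fin n → Bool) → any p (allFin n) ≡ true → ∃ λ i → p i ≡ true
  any-allFin⁻ p h with satisfied (any⁻ p (allFin _) (true⇒T h))
  ... | i , pi = i , T⇒true pi

  any-allFin⁺ : ∀ (p : Fin n → Bool) i → p i ≡ true → any p (allFin n) ≡ true
  any-allFin⁺ p i h = T⇒true (any⁺ p (lose (∈-allFin i) (true⇒T h)))

  none-allFin⁻ : ∀ (p : Fin n → Bool) → all (not ∘ p) (allFin n) ≡ true → ∀ i → p i ≡ false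
  none-allFin⁻ p h i = not-true⁻ (all-allFin⁻ (not ∘ p) h i)

  none-allFin⁺ : ∀ (p : Fin n → Bool) → (∀ i → p i ≡ false) → all (not ∘ p) (allFin n) ≡ true
  none-allFin⁺ p h = all-allFin⁺ (not ∘ p) (λ i → cong not (h i))

  not-none-allFin : ∀ (p : Fin n → Bool) → all (not ∘ p) (allFin n) ≡ false → ∃ λ i → p i ≡ true
  not-none-allFin {n} p h with any p (allFin n) in e
  ... | true = any-allFin⁻ p e
  ... | false = ⊥-elim (true≢false (none-allFin⁺ p never) h)
    where
    never : ∀ i → p i ≡ false
    never i = ≢true⇒≡false λ pi → true≢false (any-allFin⁺ p i pi) e

  𝟙 : Bool → ℕ
  𝟙 b = if b then 1 else 0

  𝟙≤1 : ∀ b → 𝟙 b ≤ 1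
  𝟙≤1 true = ≤-refl
  𝟙≤1 false = z≤n

  length-filterᵇ-tabulate : ∀ {A : Set} (g : Fin n → A) (p : A → Bool) →
                            length (filterᵇ p (tabulate g)) ≡ ∑[ i < n ] 𝟙 (p (g i))
  length-filterᵇ-tabulate {zero} g p = refl
  length-filterᵇ-tabulate {suc n} g p with p (g fzero)
  ... | true = cong suc (length-filterᵇ-tabulate (g ∘ fsuc) p)
  ... | false = length-filterᵇ-tabulate (g ∘ fsuc) p

  count≡∑𝟙 : ∀ (p : Fin n → Bool) → count p ≡ ∑[ i < n ] 𝟙 (p i)
  count≡∑𝟙 p = length-filterᵇ-tabulate (λ i → i) p

  ∑-mono-≤ : ∀ {f g : Fin n → ℕ} → (∀ i → f i ≤ g i) → sum f ≤ sum g
  ∑-mono-≤ {zero} h = z≤n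
  ∑-mono-≤ {suc n} h = +-mono-≤ (h fzero) (∑-mono-≤ (h ∘ fsuc))

  term≤∑ : ∀ (f : Fin n → ℕ) i → f i ≤ sum f
  term≤∑ f fzero = m≤m+n (f fzero) _
  term≤∑ f (fsuc i) = ≤-trans (term≤∑ (f ∘ fsuc) i) (m≤n+m _ (f fzero))

  ∑-const-1 : ∑[ i < n ] 1 ≡ n
  ∑-const-1 {zero} = refl
  ∑-const-1 {suc n} = cong suc (∑-const-1 {n})

  sum-map-tabulate : ∀ {A : Set} (f : A → ℕ) (g : Fin n → A) → List.sum (map f (tabulate g)) ≡ ∑[ i < n ] f (g i)
  sum-map-tabulate {zero} f g = refl
  sum-map-tabulate {suc n} f g = cong (f (g fzero) +_) (sum-map-tabulate f (g ∘ fsuc))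

  count-cong : ∀ {p q : Fin n → Bool} → (∀ i → p i ≡ q i) → count p ≡ count q
  count-cong {p = p} {q} h = trans (count≡∑𝟙 p) (trans (sum-cong-≗ (cong 𝟙 ∘ h)) (sym (count≡∑𝟙 q)))

  count-mono : ∀ {p q : Fin n → Bool} → (∀ i → p i ≡ true → q i ≡ true) → count p ≤ count q
  count-mono {p = p} {q} p⊆q = subst₂ _≤_ (sym (count≡∑𝟙 p)) (sym (count≡∑𝟙 q)) (∑-mono-≤ pointwise)
    where
    pointwise : ∀ i → 𝟙 (p i) ≤ 𝟙 (q i)
    pointwise i with p i in pi
    ... | false = z≤n
    ... | true rewrite p⊆q i pi = ≤-refl

  count≤n : ∀ (p : Fin n → Bool) → count p ≤ n
  count≤n {n} p = subst₂ _≤_ (sym (count≡∑𝟙 p)) (∑-const-1 {n}) (∑-mono-≤ (𝟙≤1 ∘ p))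

  count-split : ∀ (p q : Fin n → Bool) →
                count p ≡ count (λ i → p i ∧ q i) + count (λ i → p i ∧ not (q i))
  count-split p q = begin
    count p                                                 ≡⟨ count≡∑𝟙 p ⟩
    sum (λ i → 𝟙 (p i))                                     ≡⟨ sum-cong-≗ (λ i → pointwise (p i) (q i)) ⟩
    sum (λ i → 𝟙 (p i ∧ q i) + 𝟙 (p i ∧ not (q i)))         ≡⟨ ∑-distrib-+ (λ i → 𝟙 (p i ∧ q i)) _ ⟩
    sum (λ i → 𝟙 (p i ∧ q i)) + sum (λ i → 𝟙 (p i ∧ not (q i)))
      ≡⟨ sym (cong₂ _+_ (count≡∑𝟙 (λ i → p i ∧ q i)) (count≡∑𝟙 (λ i → p i ∧ not (q i)))) ⟩
    count (λ i → p i ∧ q i) + count (λ i → p i ∧ not (q i)) ∎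
    where
    open ≡-Reasoning
    pointwise : ∀ a b → 𝟙 a ≡ 𝟙 (a ∧ b) + 𝟙 (a ∧ not b)
    pointwise true true = refl
    pointwise true false = refl
    pointwise false b = refl

  count-complement : ∀ (p : Fin n → Bool) → count p + count (not ∘ p) ≡ n
  count-complement {n} p = begin
    count p + count (not ∘ p)              ≡⟨ cong₂ _+_ (count≡∑𝟙 p) (count≡∑𝟙 (not ∘ p)) ⟩
    sum (𝟙 ∘ p) + sum (𝟙 ∘ not ∘ p)        ≡⟨ ∑-distrib-+ (𝟙 ∘ p) (𝟙 ∘ not ∘ p) ⟨
    sum (λ i → 𝟙 (p i) + 𝟙 (not (p i)))    ≡⟨ sum-cong-≗ (λ i → pointwise (p i)) ⟩
    ∑[ i < n ] 1                           ≡⟨ ∑-const-1 ⟩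
    n                                      ∎
    where
    open ≡-Reasoning
    pointwise : ∀ a → 𝟙 a + 𝟙 (not a) ≡ 1
    pointwise true = refl
    pointwise false = refl

  count-pos : ∀ (p : Fin n → Bool) i → p i ≡ true → 1 ≤ count p
  count-pos p i pi = subst (1 ≤_) (sym (count≡∑𝟙 p)) (subst (_≤ _) (cong 𝟙 pi) (term≤∑ (𝟙 ∘ p) i))

  count-none : ∀ (p : Fin n → Bool) → (∀ i → p i ≡ false) → count p ≡ 0
  count-none {n} p h = trans (count≡∑𝟙 p) (trans (sum-cong-≗ (cong 𝟙 ∘ h)) (sum-replicate-zero n))

  count-witness : ∀ (p : Fin n → Bool) → 1 ≤ count p → ∃ λ i → p i ≡ true
  count-witness p h = witness p (subst (1 ≤_) (count≡∑𝟙 p) h)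
    where
    witness : ∀ {n} (p : Fin n → Bool) → 1 ≤ sum (𝟙 ∘ p) → ∃ λ i → p i ≡ true
    witness {suc n} p h with p fzero in e
    ... | true = fzero , e
    ... | false with witness (p ∘ fsuc) h
    ... | i , pi = fsuc i , pi

  count-strict-mono : ∀ {p q : Fin n → Bool} → (∀ i → p i ≡ true → q i ≡ true) →
                      ∀ b → q b ≡ true → p b ≡ false → suc (count p) ≤ count q
  count-strict-mono {p = p} {q} p⊆q b qb pb = begin
    suc (count p)                                           ≡⟨ +-comm 1 (count p) ⟩
    count p + 1                                             ≤⟨ +-mono-≤ (≤-reflexive (sym q∧p≡p)) (count-pos _ b (∧-true⁺ qb (cong not pb))) ⟩
    count (λ i → q i ∧ p i) + count (λ i → q i ∧ not (p i)) ≡⟨ count-split q p ⟨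
    count q                                                 ∎
    where
    open ≤-Reasoning
    q∧p≡p : count (λ i → q i ∧ p i) ≡ count p
    q∧p≡p = count-cong pointwise
      where
      pointwise : ∀ i → (q i ∧ p i) ≡ p i
      pointwise i with p i in pi
      ... | true rewrite p⊆q i pi = refl
      ... | false = ∧-zeroʳ (q i)

  count-mono-≥⇒⊇ : ∀ {p q : Fin n → Bool} → (∀ i → p i ≡ true → q i ≡ true) → count q ≤ count p →
                   ∀ i → q i ≡ true → p i ≡ true
  count-mono-≥⇒⊇ p⊆q q≤p i qi =
    ≢false⇒≡true λ pi → <-irrefl refl (≤-trans (count-strict-mono p⊆q i qi pi) q≤p)

  count-mono-<⇒∃ : ∀ {p q : Fin n → Bool} → (∀ i → p i ≡ true → q i ≡ true) → count p < count q →
                   ∃ λ i → q i ≡ true × p i ≡ false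
  count-mono-<⇒∃ {p = p} {q} p⊆q p<q with count-witness (λ i → q i ∧ not (p i)) gap
    where
    gap : 1 ≤ count (λ i → q i ∧ not (p i))
    gap = +-cancelˡ-≤ (count p) 1 _ (begin
      count p + 1                                          ≡⟨ +-comm (count p) 1 ⟩
      suc (count p)                                        ≤⟨ p<q ⟩
      count q                                              ≡⟨ count-split q p ⟩
      count (λ i → q i ∧ p i) + count (λ i → q i ∧ not (p i))
        ≤⟨ +-monoˡ-≤ _ (count-mono {p = λ i → q i ∧ p i} (λ i h → proj₂ (∧-true⁻ h))) ⟩
      count p + count (λ i → q i ∧ not (p i))              ∎)
      where open ≤-Reasoning
  ... | i , h = i , proj₁ (∧-true⁻ h) , not-true⁻ (proj₂ (∧-true⁻ h))

  ∑-single : ∀ (a : Fin n) w → ∑[ i < n ] (if a == i then w else 0) ≡ w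
  ∑-single {suc n} fzero w = trans (cong (w +_) (sum-replicate-zero n)) (+-identityʳ w)
  ∑-single {suc n} (fsuc a) w =
    trans (sum-cong-≗ (λ i → cong (if_then w else 0) (==-fsuc a i))) (∑-single a w)

  count-== : ∀ (a : Fin n) → count (a ==_) ≡ 1
  count-== a = trans (count≡∑𝟙 (a ==_)) (∑-single a 1)

  ∑-if-single : ∀ b (a : Fin n) w → ∑[ i < n ] (if b ∧ (a == i) then w else 0) ≡ (if b then w else 0)
  ∑-if-single {n} false a w = sum-replicate-zero n
  ∑-if-single true a w = ∑-single a w

  count-disjoint-∨ : ∀ (p q : Fin n → Bool) → (∀ i → p i ≡ true → q i ≡ true → ⊥) →
                     count p + count q ≤ count (λ i → p i ∨ q i)
  count-disjoint-∨ p q disjoint = begin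
    count p + count q                                               ≤⟨ +-mono-≤ (count-mono in-p) (count-mono in-q) ⟩
    count (λ i → (p i ∨ q i) ∧ p i) + count (λ i → (p i ∨ q i) ∧ not (p i)) ≡⟨ count-split (λ i → p i ∨ q i) p ⟨
    count (λ i → p i ∨ q i)                                         ∎
    where
    open ≤-Reasoning
    in-p : ∀ i → p i ≡ true → (p i ∨ q i) ∧ p i ≡ true
    in-p i pi = ∧-true⁺ (∨-trueˡ (q i) pi) pi
    in-q : ∀ i → q i ≡ true → (p i ∨ q i) ∧ not (p i) ≡ true
    in-q i qi = ∧-true⁺ (∨-trueʳ (p i) qi) (cong not (≢true⇒≡false λ pi → disjoint i pi qi))

  count-≤1 : ∀ (p : Fin n → Bool) → (∀ x y → p x ≡ true → p y ≡ true → x ≡ y) → count p ≤ 1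
  count-≤1 p unique with 1 ≤? count p
  ... | no 1≰count = <⇒≤ (≰⇒> 1≰count)
  ... | yes 1≤count with count-witness p 1≤count
  ...   | a , pa = ≤-trans (count-mono (λ i pi → subst (λ j → a == j ≡ true) (unique a i pa pi) (==-refl a)))
                           (≤-reflexive (count-== a))

  count-≡1 : ∀ (p : Fin n → Bool) i → p i ≡ true → (∀ x y → p x ≡ true → p y ≡ true → x ≡ y) → count p ≡ 1
  count-≡1 p i pi unique = ≤-antisym (count-≤1 p unique) (count-pos p i pi)

  minimum : ∀ (q : Fin n → Bool) x → q x ≡ true →
            ∃ λ a → q a ≡ true × (∀ b → q b ≡ true → toℕ a ≤ toℕ b)
  minimum {suc n} q x qx with q fzero in e
  ... | true = fzero , e , (λ _ _ → z≤n)
  minimum {suc n} q fzero qx | false = ⊥-elim (true≢false qx e)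
  minimum {suc n} q (fsuc x) qx | false with minimum (q ∘ fsuc) x qx
  ... | a , qa , least = fsuc a , qa , below
    where
    below : ∀ b → q b ≡ true → toℕ (fsuc a) ≤ toℕ b
    below fzero qb = ⊥-elim (true≢false qb e)
    below (fsuc b) qb = s≤s (least b qb)

  IsFirst : (Fin n → Bool) → Fin n → Bool
  IsFirst {n} q x = all (λ y → not (q y) ∨ (toℕ x ≤ᵇ toℕ y)) (allFin n)

  IsFirst-intro : ∀ {q : Fin n → Bool} {x} → (∀ y → q y ≡ true → toℕ x ≤ toℕ y) → IsFirst q x ≡ true
  IsFirst-intro {q = q} {x} below = all-allFin⁺ _ bounded
    where
    bounded : ∀ y → not (q y) ∨ (toℕ x ≤ᵇ toℕ y) ≡ true
    bounded y with q y in qy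
    ... | false = refl
    ... | true = T⇒true (≤⇒≤ᵇ (below y qy))

  IsFirst-minimal : ∀ {q : Fin n → Bool} {x y} → IsFirst q x ≡ true → q y ≡ true → toℕ x ≤ toℕ y
  IsFirst-minimal {q = q} {x} {y} first qy with ∨-true⁻ {not (q y)} (all-allFin⁻ _ first y)
  ... | inj₁ ¬qy = ⊥-elim (true≢false qy (not-true⁻ ¬qy))
  ... | inj₂ x≤y = ≤ᵇ⇒≤ (toℕ x) (toℕ y) (true⇒T x≤y)

  𝟙≡count : ∀ b (q : Fin n → Bool) → (∀ i → q i ≡ true → b ≡ true) → (b ≡ true → ∃ λ i → q i ≡ true) →
            (∀ i j → q i ≡ true → q j ≡ true → i ≡ j) → 𝟙 b ≡ count q
  𝟙≡count true q _ exists unique with exists refl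
  ... | i , qi = sym (count-≡1 q i qi unique)
  𝟙≡count false q sound _ _ = sym (count-none q λ i → ≢true⇒≡false λ qi → true≢false (sound i qi) refl)

  count-matching : ∀ {m} (P : Fin n → Bool) (R : Fin m → Bool) (Q : Fin n → Fin m → Bool) →
                   (∀ a → 𝟙 (P a) ≡ count (Q a)) → (∀ r → 𝟙 (R r) ≡ count (λ a → Q a r)) →
                   count P ≡ count R
  count-matching P R Q P≡ R≡ = begin
    count P                                 ≡⟨ count≡∑𝟙 P ⟩
    sum (𝟙 ∘ P)                             ≡⟨ sum-cong-≗ (λ a → trans (P≡ a) (count≡∑𝟙 (Q a))) ⟩
    sum (λ a → sum (λ r → 𝟙 (Q a r)))       ≡⟨ ∑-comm (λ a r → 𝟙 (Q a r)) ⟩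
    sum (λ r → sum (λ a → 𝟙 (Q a r)))       ≡⟨ sum-cong-≗ (λ r → trans (R≡ r) (count≡∑𝟙 (λ a → Q a r))) ⟨
    sum (𝟙 ∘ R)                             ≡⟨ count≡∑𝟙 R ⟨
    count R                                 ∎
    where open ≡-Reasoning

  nonroots : Digraph n → ℕ
  nonroots F = count (not ∘ indeg0 F)

  module _ (F : Digraph n) where

    indeg0⇒no-arc : ∀ {u} → indeg0 F u ≡ true → ∀ w → F w u ≡ false
    indeg0⇒no-arc = none-allFin⁻ _

    no-arc⇒indeg0 : ∀ {u} → (∀ w → F w u ≡ false) → indeg0 F u ≡ true
    no-arc⇒indeg0 = none-allFin⁺ _

    ¬indeg0⇒arc : ∀ {u} → indeg0 F u ≡ false → ∃ λ w → F w u ≡ true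
    ¬indeg0⇒arc = not-none-allFin _

    arc⇒¬indeg0 : ∀ {w u} → F w u ≡ true → indeg0 F u ≡ false
    arc⇒¬indeg0 {w} e = ≢true⇒≡false λ r → true≢false e (indeg0⇒no-arc r w)

    outdeg0⇒no-arc : ∀ {v} → outdeg0 F v ≡ true → ∀ u → F v u ≡ false
    outdeg0⇒no-arc = none-allFin⁻ _

    no-arc⇒outdeg0 : ∀ {v} → (∀ u → F v u ≡ false) → outdeg0 F v ≡ true
    no-arc⇒outdeg0 = none-allFin⁺ _

    ¬outdeg0⇒arc : ∀ {v} → outdeg0 F v ≡ false → ∃ λ u → F v u ≡ true
    ¬outdeg0⇒arc = not-none-allFin _

    arc⇒¬outdeg0 : ∀ {v u} → F v u ≡ true → outdeg0 F v ≡ false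
    arc⇒¬outdeg0 {u = u} e = ≢true⇒≡false λ o → true≢false e (outdeg0⇒no-arc o u)

  module _ {F G : Digraph n} (F⊆G : F ⊆ᴬ G) where

    ¬indeg0-mono : ∀ {u} → indeg0 F u ≡ false → indeg0 G u ≡ false
    ¬indeg0-mono r with ¬indeg0⇒arc F r
    ... | w , e = arc⇒¬indeg0 G (F⊆G _ _ e)

    indeg0-antimono : ∀ {u} → indeg0 G u ≡ true → indeg0 F u ≡ true
    indeg0-antimono r = no-arc⇒indeg0 F λ w → ≢true⇒≡false λ e → true≢false (F⊆G _ _ e) (indeg0⇒no-arc G r w)

    ¬outdeg0-mono : ∀ {v} → outdeg0 F v ≡ false → outdeg0 G v ≡ false
    ¬outdeg0-mono o with ¬outdeg0⇒arc F o
    ... | u , e = arc⇒¬outdeg0 G (F⊆G _ _ e)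

    outdeg0-antimono : ∀ {v} → outdeg0 G v ≡ true → outdeg0 F v ≡ true
    outdeg0-antimono o = ≢false⇒≡true λ o' → true≢false o (¬outdeg0-mono o')

  unique-length≤ : ∀ {xs : List (Fin n)} → Unique xs → length xs ≤ n
  unique-length≤ {n} {xs} u with length xs ≤? n
  ... | yes le = le
  ... | no nle with pigeonhole (≰⇒> nle) (lookup xs)
  ... | i , j , i<j , eq = ⊥-elim (<-irrefl (cong toℕ (lookup-injective u i j eq)) i<j)
    where
    lookup-injective : ∀ {xs : List (Fin n)} → Unique xs → ∀ i j → lookup xs i ≡ lookup xs j → i ≡ j
    lookup-injective (_ ∷ _) fzero fzero _ = refl
    lookup-injective (x∉ ∷ _) fzero (fsuc j) eq = ⊥-elim (All-lookup x∉ (∈-lookup j) eq)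
    lookup-injective (x∉ ∷ _) (fsuc i) fzero eq = ⊥-elim (All-lookup x∉ (∈-lookup i) (sym eq))
    lookup-injective (_ ∷ u) (fsuc i) (fsuc j) eq = cong fsuc (lookup-injective u i j eq)

  module _ {A : Digraph n} where

    walk-mono : ∀ {B} → A ⊆ᴬ B → ∀ {u v xs} → Walk A u v xs → Walk B u v xs
    walk-mono A⊆B here = here
    walk-mono A⊆B (step e w) = step (A⊆B _ _ e) (walk-mono A⊆B w)

    walk-suffix : ∀ {w v u ys} → Walk A w v ys → u ∈ ys → Unique ys → ∃ λ zs → DirPath A u v zs
    walk-suffix here (here refl) u = _ , here , u
    walk-suffix (step e p) (here refl) u = _ , step e p , u
    walk-suffix (step e p) (there m) (_ ∷ u) = walk-suffix p m u

    walk⇒dirPath : ∀ {u v xs} → Walk A u v xs → ∃ λ ys → DirPath A u v ys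
    walk⇒dirPath here = _ , here , [] ∷ []
    walk⇒dirPath {u = u} (step e w) with walk⇒dirPath w
    ... | ys , p , uniq with DecMembership._∈?_ _≟ᶠ_ u ys
    ... | yes u∈ys = walk-suffix p u∈ys uniq
    ... | no u∉ys = u ∷ ys , step e p , ¬Any⇒All¬ ys u∉ys ∷ uniq

    walk-prefix : ∀ {b a c xs} → Walk A b a xs → c ∈ xs → ∃ λ ys → Walk A b c ys
    walk-prefix here (here refl) = _ , here
    walk-prefix (step e p) (here refl) = _ , here
    walk-prefix (step e p) (there m) with walk-prefix p m
    ... | ys , q = _ , step e q

    walk-snoc : ∀ {a b c xs} → Walk A a b xs → A b c ≡ true → Walk A a c (xs ++ c ∷ [])
    walk-snoc here e = step e here
    walk-snoc (step f w) e = step f (walk-snoc w e)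

    walk-ends-with : ∀ {a b xs} → Walk A a b xs → ∃ λ zs → xs ≡ zs ++ b ∷ []
    walk-ends-with here = [] , refl
    walk-ends-with {a = a} (step e w) with walk-ends-with w
    ... | zs , refl = a ∷ zs , refl

  unique-snoc : ∀ {xs : List (Fin n)} {u} → Unique xs → u ∉ xs → Unique (xs ++ u ∷ [])
  unique-snoc {xs = []} [] _ = [] ∷ []
  unique-snoc {xs = x ∷ xs} (x∉ ∷ u) u∉ =
    All++⁺ x∉ ((λ x≡u → u∉ (here (sym x≡u))) ∷ []) ∷ unique-snoc u (u∉ ∘ there)

  data Reaches (F : Digraph n) (r : Fin n) : Fin n → Set where
    ε : Reaches F r r
    _▸_ : ∀ {p a} → Reaches F r p → F p a ≡ true → Reaches F r a

  module _ {F : Digraph n} where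

    ◂-Reaches : ∀ {b w a} → F b w ≡ true → Reaches F w a → Reaches F b a
    ◂-Reaches e ε = ε ▸ e
    ◂-Reaches e (q ▸ f) = ◂-Reaches e q ▸ f

    walk⇒Reaches : ∀ {b a xs} → Walk F b a xs → Reaches F b a
    walk⇒Reaches here = ε
    walk⇒Reaches (step e w) = ◂-Reaches e (walk⇒Reaches w)

    Reaches-first-arc : ∀ {r c} → Reaches F r c → ¬ r ≡ c → ∃ λ w → F r w ≡ true
    Reaches-first-arc ε r≢c = ⊥-elim (r≢c refl)
    Reaches-first-arc {r} (_▸_ {p = p} q e) r≢c with r ≟ᶠ p
    ... | yes refl = _ , e
    ... | no r≢p = Reaches-first-arc q r≢p

  module Components (F : Digraph n) where

    reachU-stay : ∀ k {a b} → reachU F k a b ≡ true → reachU F (suc k) a b ≡ true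
    reachU-stay k h = ∨-trueˡ _ h

    reachU-step : ∀ k {a c b} → reachU F k a c ≡ true → adjU F c b ≡ true → reachU F (suc k) a b ≡ true
    reachU-step k {a} {c} {b} h e =
      ∨-trueʳ (reachU F k a b) (any-allFin⁺ (λ c → reachU F k a c ∧ adjU F c b) c (∧-true⁺ h e))

    reachU-suc⁻ : ∀ k {a b} → reachU F (suc k) a b ≡ true →
                  reachU F k a b ≡ true ⊎ ∃ λ c → reachU F k a c ≡ true × adjU F c b ≡ true
    reachU-suc⁻ k {a} {b} h with ∨-true⁻ {reachU F k a b} h
    ... | inj₁ stay = inj₁ stay
    ... | inj₂ moved with any-allFin⁻ (λ c → reachU F k a c ∧ adjU F c b) moved
    ... | c , q = inj₂ (c , ∧-true⁻ q)

    reachU-from-0 : ∀ j {a b} → reachU F 0 a b ≡ true → reachU F j a b ≡ true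
    reachU-from-0 zero h = h
    reachU-from-0 (suc j) h = reachU-stay j (reachU-from-0 j h)

    module Saturation (a : Fin n) where

      Saturated : ℕ → Set
      Saturated j = ∀ b → reachU F (suc j) a b ≡ true → reachU F j a b ≡ true

      saturated⇒⊇ : ∀ j → Saturated j → ∀ m b → reachU F m a b ≡ true → reachU F j a b ≡ true
      saturated⇒⊇ j sat zero b h = reachU-from-0 j h
      saturated⇒⊇ j sat (suc m) b h with reachU-suc⁻ m h
      ... | inj₁ stay = saturated⇒⊇ j sat m b stay
      ... | inj₂ (c , q , e) = sat b (reachU-step j (saturated⇒⊇ j sat m c q) e)

      saturated-suc : ∀ j → Saturated j → Saturated (suc j)
      saturated-suc j sat b h = reachU-stay j (saturated⇒⊇ j sat (suc (suc j)) b h)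

      -- The sets reachU F j a grow with j, and once they stop growing they are constant;
      -- since they live in Fin n they are constant from j = n on.
      grows-or-saturates : ∀ j → suc j ≤ count (reachU F j a) ⊎ Saturated j
      grows-or-saturates zero = inj₁ (count-pos _ a (==-refl a))
      grows-or-saturates (suc j) with grows-or-saturates j
      ... | inj₂ sat = inj₂ (saturated-suc j sat)
      ... | inj₁ grown with any (λ b → reachU F (suc j) a b ∧ not (reachU F j a b)) (allFin n) in new
      ... | true with any-allFin⁻ _ new
      ...   | b , q = inj₁ (≤-trans (s≤s grown)
                            (count-strict-mono {p = reachU F j a} (λ i → reachU-stay j) b (proj₁ (∧-true⁻ q)) (not-true⁻ (proj₂ (∧-true⁻ q)))))
      grows-or-saturates (suc j) | inj₁ grown | false = inj₂ (saturated-suc j sat)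
        where
        sat : Saturated j
        sat b h = ≢false⇒≡true λ old →
          true≢false (any-allFin⁺ _ b (∧-true⁺ h (cong not old))) new

    reachU⇒sameComp : ∀ k {a b} → reachU F k a b ≡ true → sameComp F a b ≡ true
    reachU⇒sameComp k {a} {b} h with Saturation.grows-or-saturates a n
    ... | inj₁ grown = ⊥-elim (<-irrefl refl (≤-trans grown (count≤n _)))
    ... | inj₂ sat = Saturation.saturated⇒⊇ a n sat k b h

    sameComp-refl : ∀ a → sameComp F a a ≡ true
    sameComp-refl a = reachU⇒sameComp 0 (==-refl a)

    adjU⇒sameComp : ∀ {a b} → adjU F a b ≡ true → sameComp F a b ≡ true
    adjU⇒sameComp {a} e = reachU⇒sameComp 1 (reachU-step 0 (==-refl a) e)

    sameComp-trans : ∀ {a b c} → sameComp F a b ≡ true → sameComp F b c ≡ true → sameComp F a c ≡ true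
    sameComp-trans = extend n
      where
      extend : ∀ k {a b c} → sameComp F a b ≡ true → reachU F k b c ≡ true → sameComp F a c ≡ true
      extend zero h e with ==⇒≡ e
      ... | refl = h
      extend (suc k) h e with reachU-suc⁻ k e
      ... | inj₁ stay = extend k h stay
      ... | inj₂ (d , q , g) = reachU⇒sameComp (suc n) (reachU-step n (extend k h q) g)

    adjU-sym : ∀ {a b} → adjU F a b ≡ true → adjU F b a ≡ true
    adjU-sym {a} {b} e with ∨-true⁻ {F a b} e
    ... | inj₁ ab = ∨-trueʳ (F b a) ab
    ... | inj₂ ba = ∨-trueˡ (F a b) ba

    sameComp-sym : ∀ {a b} → sameComp F a b ≡ true → sameComp F b a ≡ true
    sameComp-sym = reverse n
      where
      reverse : ∀ k {a b} → reachU F k a b ≡ true → sameComp F b a ≡ true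
      reverse zero e with ==⇒≡ e
      ... | refl = sameComp-refl _
      reverse (suc k) e with reachU-suc⁻ k e
      ... | inj₁ stay = reverse k stay
      ... | inj₂ (c , q , g) = sameComp-trans (adjU⇒sameComp (adjU-sym g)) (reverse k q)

    Reaches⇒sameComp : ∀ {r a} → Reaches F r a → sameComp F r a ≡ true
    Reaches⇒sameComp ε = sameComp-refl _
    Reaches⇒sameComp (q ▸ e) = sameComp-trans (Reaches⇒sameComp q) (adjU⇒sameComp (∨-trueˡ _ e))

  -- Branchings

  record IsBranching (F : Digraph n) : Set where
    field
      acyclic : ∀ {b c xs} → F c b ≡ true → ¬ Walk F b c xs
      indeg≤1 : ∀ {a b c} → F a c ≡ true → F b c ≡ true → a ≡ b

  dag-subgraph-acyclic : ∀ {D F : Digraph n} → IsDag D → F ⊆ᴬ D →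
                         ∀ {b c xs} → F c b ≡ true → ¬ Walk F b c xs
  dag-subgraph-acyclic dag F⊆D e w with walk⇒dirPath (walk-mono F⊆D w)
  ... | ys , p = dag _ _ ys (F⊆D _ _ e) p

  module Branching {F : Digraph n} (isBranching : IsBranching F) where
    open IsBranching isBranching
    open Components F

    root-unique : ∀ {r₁ r₂ a} → Reaches F r₁ a → Reaches F r₂ a →
                  indeg0 F r₁ ≡ true → indeg0 F r₂ ≡ true → r₁ ≡ r₂
    root-unique ε ε _ _ = refl
    root-unique ε (_ ▸ e) root₁ _ = ⊥-elim (true≢false e (indeg0⇒no-arc F root₁ _))
    root-unique (_ ▸ e) ε _ root₂ = ⊥-elim (true≢false e (indeg0⇒no-arc F root₂ _))
    root-unique (q₁ ▸ e₁) (q₂ ▸ e₂) root₁ root₂ with indeg≤1 e₁ e₂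
    ... | refl = root-unique q₁ q₂ root₁ root₂

    root-exists : ∀ a → ∃ λ r → indeg0 F r ≡ true × Reaches F r a
    root-exists a = climb (suc n) a (a ∷ []) here ([] ∷ []) (n≤1+n (suc n))
      where
      -- Follow in-arcs backwards; acyclicity keeps the visited nodes distinct, so there are at most n.
      climb : ∀ fuel b xs → Walk F b a xs → Unique xs → suc n ≤ length xs + fuel →
              ∃ λ r → indeg0 F r ≡ true × Reaches F r a
      climb zero b xs w u long =
        ⊥-elim (<-irrefl refl (≤-trans long (≤-trans (≤-reflexive (+-identityʳ _)) (unique-length≤ u))))
      climb (suc fuel) b xs w u long with indeg0 F b in root
      ... | true = b , root , walk⇒Reaches w
      ... | false with ¬indeg0⇒arc F root
      ... | c , e with DecMembership._∈?_ _≟ᶠ_ c xs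
      ... | yes c∈xs = ⊥-elim (acyclic e (proj₂ (walk-prefix w c∈xs)))
      ... | no c∉xs = climb fuel c (c ∷ xs) (step e w) (¬Any⇒All¬ xs c∉xs ∷ u)
                        (subst (suc n ≤_) (+-suc (length xs) fuel) long)

    sameComp⇒same-root : ∀ {a b r r′} → sameComp F a b ≡ true →
                         Reaches F r a → indeg0 F r ≡ true → Reaches F r′ b → indeg0 F r′ ≡ true → r ≡ r′
    sameComp⇒same-root = along n
      where
      along : ∀ k {a b r r′} → reachU F k a b ≡ true →
              Reaches F r a → indeg0 F r ≡ true → Reaches F r′ b → indeg0 F r′ ≡ true → r ≡ r′
      along zero e q root q′ root′ with ==⇒≡ e
      ... | refl = root-unique q q′ root root′
      along (suc k) e q root q′ root′ with reachU-suc⁻ k e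
      ... | inj₁ stay = along k stay q root q′ root′
      ... | inj₂ (c , x , adj) with root-exists c | ∨-true⁻ adj
      ...   | r″ , root″ , q″ | inj₁ e′ = trans (along k x q root q″ root″) (root-unique (q″ ▸ e′) q′ root″ root′)
      ...   | r″ , root″ , q″ | inj₂ e′ = trans (along k x q root q″ root″) (root-unique q″ (q′ ▸ e′) root″ root′)

    HasOut : Fin n → Bool
    HasOut b = any (λ c → F b c) (allFin n)

    Least : Fin n → Bool
    Least a = inNontrivComp F a ∧ IsFirst (sameComp F a) a

    RootWithOut : Fin n → Bool
    RootWithOut r = indeg0 F r ∧ HasOut r

    nonroot⇒nontrivial : ∀ {a} → indeg0 F a ≡ false → inNontrivComp F a ≡ true
    nonroot⇒nontrivial {a} nonroot with ¬indeg0⇒arc F nonroot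
    ... | w , e = any-allFin⁺ _ w (∧-true⁺ (adjU⇒sameComp (∨-trueʳ (F a w) e)) (any-allFin⁺ _ a e))

    root-of-nontrivial-has-out : ∀ {a r} → Reaches F r a → indeg0 F r ≡ true →
                                 inNontrivComp F a ≡ true → HasOut r ≡ true
    root-of-nontrivial-has-out {a} {r} q root nt with any-allFin⁻ _ nt
    ... | b , x with ∧-true⁻ x
    ... | a~b , out with any-allFin⁻ _ out
    ... | c , e with root-exists c
    ... | r′ , root′ , q′ with sameComp⇒same-root (sameComp-trans a~b (adjU⇒sameComp (∨-trueˡ _ e))) q root q′ root′
    ... | refl with Reaches-first-arc q′ (λ r≡c → true≢false e (indeg0⇒no-arc F (subst _ r≡c root) b))
    ... | w , e′ = any-allFin⁺ _ w e′

    root-nontrivial≡HasOut : ∀ {r} → indeg0 F r ≡ true → inNontrivComp F r ≡ HasOut r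
    root-nontrivial≡HasOut {r} root = true⇔⇒≡
      (root-of-nontrivial-has-out ε root)
      (λ out → any-allFin⁺ _ r (∧-true⁺ (sameComp-refl r) out))

    -- Kcomps counts each nontrivial component by its least node; matching that node with the
    -- unique root of its component (which has an out-arc) shows that Kcomps F = count RootWithOut.
    Matched : Fin n → Fin n → Bool
    Matched a r = Least a ∧ (RootWithOut r ∧ sameComp F a r)

    Matched⁻ : ∀ {a r} → Matched a r ≡ true →
               Least a ≡ true × RootWithOut r ≡ true × sameComp F a r ≡ true
    Matched⁻ {a} {r} m with ∧-true⁻ {Least a} m
    ... | least , x with ∧-true⁻ {RootWithOut r} x
    ... | rw , a~r = least , rw , a~r

    Matched⁺ : ∀ {a r} → Least a ≡ true → RootWithOut r ≡ true → sameComp F a r ≡ true → Matched a r ≡ true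
    Matched⁺ least rw a~r = ∧-true⁺ least (∧-true⁺ rw a~r)

    least-matched : ∀ a → 𝟙 (Least a) ≡ count (Matched a)
    least-matched a = 𝟙≡count (Least a) (Matched a) (λ r m → proj₁ (Matched⁻ m)) exists unique
      where
      exists : Least a ≡ true → ∃ λ r → Matched a r ≡ true
      exists least with root-exists a
      ... | r , root , q = r , Matched⁺ least (∧-true⁺ root out) (sameComp-sym (Reaches⇒sameComp q))
        where out = root-of-nontrivial-has-out q root (proj₁ (∧-true⁻ {inNontrivComp F a} least))
      unique : ∀ r r′ → Matched a r ≡ true → Matched a r′ ≡ true → r ≡ r′
      unique r r′ m m′ with Matched⁻ m | Matched⁻ m′
      ... | _ , rw , a~r | _ , rw′ , a~r′ =
        sameComp⇒same-root (sameComp-trans (sameComp-sym a~r) a~r′)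
          ε (proj₁ (∧-true⁻ {indeg0 F r} rw)) ε (proj₁ (∧-true⁻ {indeg0 F r′} rw′))

    root-matched : ∀ r → 𝟙 (RootWithOut r) ≡ count (λ a → Matched a r)
    root-matched r = 𝟙≡count (RootWithOut r) (λ a → Matched a r)
                       (λ a m → proj₁ (proj₂ (Matched⁻ m))) exists unique
      where
      exists : RootWithOut r ≡ true → ∃ λ a → Matched a r ≡ true
      exists rw with minimum (sameComp F r) r (sameComp-refl r)
      ... | a , r~a , below = a , Matched⁺ least rw (sameComp-sym r~a)
        where
        least : Least a ≡ true
        least = ∧-true⁺ (any-allFin⁺ _ r (∧-true⁺ (sameComp-sym r~a) (proj₂ (∧-true⁻ {indeg0 F r} rw))))
                        (IsFirst-intro λ b a~b → below b (sameComp-trans r~a a~b))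
      unique : ∀ a a′ → Matched a r ≡ true → Matched a′ r ≡ true → a ≡ a′
      unique a a′ m m′ with Matched⁻ m | Matched⁻ m′
      ... | least , _ , a~r | least′ , _ , a′~r = toℕ-injective (≤-antisym
        (IsFirst-minimal (proj₂ (∧-true⁻ {inNontrivComp F a} least)) (sameComp-trans a~r (sameComp-sym a′~r)))
        (IsFirst-minimal (proj₂ (∧-true⁻ {inNontrivComp F a′} least′)) (sameComp-trans a′~r (sameComp-sym a~r))))

    Nnodes≡Kcomps+nonroots : Nnodes F ≡ Kcomps F + nonroots F
    Nnodes≡Kcomps+nonroots = begin
      Nnodes F
        ≡⟨ count-split (inNontrivComp F) (indeg0 F) ⟩
      count (λ a → inNontrivComp F a ∧ indeg0 F a) + count (λ a → inNontrivComp F a ∧ not (indeg0 F a))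
        ≡⟨ cong₂ _+_ (count-cong nontrivial-root) (count-cong nontrivial-nonroot) ⟩
      count RootWithOut + nonroots F
        ≡⟨ cong (_+ nonroots F) (count-matching Least RootWithOut Matched least-matched root-matched) ⟨
      Kcomps F + nonroots F
        ∎
      where
      open ≡-Reasoning
      nontrivial-root : ∀ a → inNontrivComp F a ∧ indeg0 F a ≡ RootWithOut a
      nontrivial-root a with indeg0 F a in root
      ... | true = trans (∧-identityʳ _) (root-nontrivial≡HasOut root)
      ... | false = ∧-zeroʳ _
      nontrivial-nonroot : ∀ a → inNontrivComp F a ∧ not (indeg0 F a) ≡ not (indeg0 F a)
      nontrivial-nonroot a with indeg0 F a in root
      ... | true = ∧-zeroʳ _
      ... | false = trans (∧-identityʳ _) (nonroot⇒nontrivial root)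

  -- Greedy expansion

  module Greedy (D : Digraph n) (t : ℕ) where

    Expands : Digraph n → Fin n → Bool
    Expands F v = outdeg0 F v ∧ (t ≤ᵇ count (Aset D F v))

    expand : Digraph n → Fin n → Digraph n
    expand F v a b = F a b ∨ ((a == v) ∧ Aset D F v b)

    step-cases : ∀ F v → (Expands F v ≡ false × greedyStep D t F v ≡ F) ⊎
                         (Expands F v ≡ true × greedyStep D t F v ≡ expand F v)
    step-cases F v with Expands F v
    ... | true = inj₂ (refl , refl)
    ... | false = inj₁ (refl , refl)

    expand⁻ : ∀ F v {a b} → expand F v a b ≡ true → F a b ≡ true ⊎ (a ≡ v × D v b ≡ true × indeg0 F b ≡ true)
    expand⁻ F v {a} {b} e with ∨-true⁻ {F a b} e
    ... | inj₁ old = inj₁ old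
    ... | inj₂ new with ∧-true⁻ {a == v} new
    ... | a=v , x with ==⇒≡ a=v
    ... | refl = inj₂ (refl , ∧-true⁻ x)

    expand-mono : ∀ F v → F ⊆ᴬ expand F v
    expand-mono F v a b e = ∨-trueˡ _ e

    step-mono : ∀ F v → F ⊆ᴬ greedyStep D t F v
    step-mono F v a b e with step-cases F v
    ... | inj₁ (_ , eq) = subst (λ G → G a b ≡ true) (sym eq) e
    ... | inj₂ (_ , eq) = subst (λ G → G a b ≡ true) (sym eq) (expand-mono F v a b e)

    record Invariant (F : Digraph n) : Set where
      field
        ⊆D : F ⊆ᴬ D
        indeg≤1 : ∀ {a b c} → F a c ≡ true → F b c ≡ true → a ≡ b
        successors-covered : ∀ {v u} → outdeg0 F v ≡ false → D v u ≡ true → indeg0 F u ≡ false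

    open Invariant

    expand-invariant : ∀ F v → Invariant F → Invariant (expand F v)
    expand-invariant F v inv = record
      { ⊆D = ⊆D′ ; indeg≤1 = indeg≤1′ ; successors-covered = covered′ }
      where
      ⊆D′ : expand F v ⊆ᴬ D
      ⊆D′ a b e with expand⁻ F v e
      ... | inj₁ old = ⊆D inv a b old
      ... | inj₂ (refl , d , _) = d
      indeg≤1′ : ∀ {a b c} → expand F v a c ≡ true → expand F v b c ≡ true → a ≡ b
      indeg≤1′ {a} {b} {c} e e′ with expand⁻ F v e | expand⁻ F v e′
      ... | inj₁ old | inj₁ old′ = indeg≤1 inv old old′
      ... | inj₁ old | inj₂ (_ , _ , root) = ⊥-elim (true≢false old (indeg0⇒no-arc F root a))
      ... | inj₂ (_ , _ , root) | inj₁ old′ = ⊥-elim (true≢false old′ (indeg0⇒no-arc F root b))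
      ... | inj₂ (refl , _) | inj₂ (refl , _) = refl
      covered′ : ∀ {w u} → outdeg0 (expand F v) w ≡ false → D w u ≡ true → indeg0 (expand F v) u ≡ false
      covered′ {w} {u} out d with ¬outdeg0⇒arc (expand F v) out
      ... | b , e with expand⁻ F v e
      ... | inj₁ old = ¬indeg0-mono (expand-mono F v) (successors-covered inv (arc⇒¬outdeg0 F old) d)
      ... | inj₂ (refl , _) = by-cases (indeg0 F u) refl
        where
        by-cases : ∀ b → indeg0 F u ≡ b → indeg0 (expand F v) u ≡ false
        by-cases false root = ¬indeg0-mono (expand-mono F v) root
        by-cases true root = arc⇒¬indeg0 (expand F v) (∨-trueʳ (F v u) (∧-true⁺ (==-refl v) (∧-true⁺ d root)))

    step-invariant : ∀ F v → Invariant F → Invariant (greedyStep D t F v)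
    step-invariant F v inv with step-cases F v
    ... | inj₁ (_ , eq) = subst Invariant (sym eq) inv
    ... | inj₂ (_ , eq) = subst Invariant (sym eq) (expand-invariant F v inv)

    F₀-invariant : Invariant F₀
    F₀-invariant = record
      { ⊆D = λ _ _ ()
      ; indeg≤1 = λ ()
      ; successors-covered = λ {v} out _ → ⊥-elim (true≢false (no-arc⇒outdeg0 F₀ {v} (λ _ → refl)) out)
      }

    GreedyExpand-invariant : ∀ order F → Invariant F → Invariant (GreedyExpand D t F order)
    GreedyExpand-invariant [] F inv = inv
    GreedyExpand-invariant (v ∷ order) F inv = GreedyExpand-invariant order _ (step-invariant F v inv)

    Settled : Digraph n → Fin n → Set
    Settled F v = outdeg0 F v ≡ true → count (Aset D F v) < t

    Aset-antimono : ∀ {F G} → F ⊆ᴬ G → ∀ v → count (Aset D G v) ≤ count (Aset D F v)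
    Aset-antimono F⊆G v = count-mono λ u e →
      ∧-true⁺ (proj₁ (∧-true⁻ {D v u} e)) (indeg0-antimono F⊆G (proj₂ (∧-true⁻ {D v u} e)))

    step-keeps-settled : ∀ F w v → Settled F v → Settled (greedyStep D t F w) v
    step-keeps-settled F w v settled out =
      ≤-trans (s≤s (Aset-antimono (step-mono F w) v)) (settled (outdeg0-antimono (step-mono F w) out))

    step-settles : 1 ≤ t → ∀ F v → Settled (greedyStep D t F v) v
    step-settles t≥1 F v with step-cases F v
    ... | inj₁ (skipped , eq) rewrite eq = λ out →
      ≰⇒> λ t≤count → true≢false (∧-true⁺ out (T⇒true (≤⇒≤ᵇ t≤count))) skipped
    ... | inj₂ (expanded , eq) rewrite eq = λ out → ⊥-elim (true≢false out (arc⇒¬outdeg0 (expand F v) new))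
      where
      some : ∃ λ u → Aset D F v u ≡ true
      some = count-witness _ (≤-trans t≥1 (≤ᵇ⇒≤ t _ (true⇒T (proj₂ (∧-true⁻ {outdeg0 F v} expanded)))))
      new : expand F v v (proj₁ some) ≡ true
      new = ∨-trueʳ (F v _) (∧-true⁺ (==-refl v) (proj₂ some))

    GreedyExpand-settles : 1 ≤ t → ∀ order F v → Settled F v ⊎ v ∈ order → Settled (GreedyExpand D t F order) v
    GreedyExpand-settles t≥1 [] F v (inj₁ settled) = settled
    GreedyExpand-settles t≥1 (w ∷ order) F v (inj₁ settled) =
      GreedyExpand-settles t≥1 order _ v (inj₁ (step-keeps-settled F w v settled))
    GreedyExpand-settles t≥1 (w ∷ order) F v (inj₂ (here refl)) =
      GreedyExpand-settles t≥1 order _ v (inj₁ (step-settles t≥1 F v))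
    GreedyExpand-settles t≥1 (w ∷ order) F v (inj₂ (there v∈order)) =
      GreedyExpand-settles t≥1 order _ v (inj₂ v∈order)

    GreedyExpand-settled : 1 ≤ t → ∀ {order} → order ↭ allFin n →
                           ∀ v → outdeg0 (GreedyExpand D t F₀ order) v ≡ true →
                           count (Uset D (GreedyExpand D t F₀ order) v) < t
    GreedyExpand-settled t≥1 {order} perm v out =
      subst (_< t) (count-cong λ u → ∧-comm (D v u) (indeg0 (GreedyExpand D t F₀ order) u))
        (GreedyExpand-settles t≥1 order F₀ v (inj₂ (∈-resp-↭ (↭-sym perm) (∈-allFin v))) out)

    GreedyExpand-branching : IsDag D → ∀ order → IsBranching (GreedyExpand D t F₀ order)
    GreedyExpand-branching dag order = record
      { acyclic = dag-subgraph-acyclic dag (⊆D inv) ; indeg≤1 = indeg≤1 inv }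
      where
      inv : Invariant (GreedyExpand D t F₀ order)
      inv = GreedyExpand-invariant order F₀ F₀-invariant

  module CandidateSets (D F : Digraph n) where

    cs : List (Cand n)
    cs = Candidates D F

    U : Fin n → Fin n → Bool
    U = Uset D F

    Sound : Cand n → Set
    Sound (v , C) = (∀ z → C z ≡ true → U v z ≡ true) × count C ≤ 3

    Listed : Fin n → Bool
    Listed v = outdeg0 F v ∧ (2 ≤ᵇ count (U v)) ∧ (count (U v) ≤ᵇ 3)

    Listed⁻ : ∀ v → Listed v ≡ true → outdeg0 F v ≡ true × 2 ≤ count (U v) × count (U v) ≤ 3
    Listed⁻ v listed with ∧-true⁻ {outdeg0 F v} listed
    ... | out , sizes with ∧-true⁻ {2 ≤ᵇ count (U v)} sizes
    ... | ≥2 , ≤3 = out , ≤ᵇ⇒≤ 2 _ (true⇒T ≥2) , ≤ᵇ⇒≤ _ 3 (true⇒T ≤3)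

    Listed⁺ : ∀ v → outdeg0 F v ≡ true → 2 ≤ count (U v) → count (U v) ≤ 3 → Listed v ≡ true
    Listed⁺ v out ≥2 ≤3 =
      ∧-true⁺ out (∧-true⁺ (T⇒true (≤⇒≤ᵇ ≥2)) (T⇒true (≤⇒≤ᵇ ≤3)))

    one-removed : Fin n → Fin n → Cand n
    one-removed v u = v , λ x → U v x ∧ not (x == u)

    Removals : Fin n → Bool → List (Cand n)
    Removals v b = if b then map (one-removed v) (filterᵇ (U v) (allFin n)) else []

    one-removed-sound : ∀ v b {c} → count (U v) ≤ 3 → c ∈ Removals v b → Sound c
    one-removed-sound v true ≤3 c∈ with ∈-map⁻ _ c∈
    ... | u , _ , refl = (λ z h → proj₁ (∧-true⁻ {U v z} h)) , ≤-trans (count-mono λ z h → proj₁ (∧-true⁻ {U v z} h)) ≤3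

    candidatesOf-sound : ∀ v {c} → c ∈ candidatesOf D F v → Sound c
    candidatesOf-sound v {c} c∈
      with Listed v in cond
    ... | true with c∈ | Listed⁻ v cond
    ...   | here refl | _ , _ , ≤3 = (λ _ h → h) , ≤3
    ...   | there c∈′ | _ , _ , ≤3 = one-removed-sound v _ ≤3 c∈′

    candidate-sound : ∀ x → (∀ z → Uof cs x z ≡ true → U (nodeOf cs x) z ≡ true) × count (Uof cs x) ≤ 3
    candidate-sound x with satisfied (∈-concatMap⁻ (candidatesOf D F) {xs = allFin n} (∈-lookup x))
    ... | v , c∈ = candidatesOf-sound v c∈

    Candidate-for : Fin n → (Fin n → Bool) → Set
    Candidate-for p C = ∃ λ x → nodeOf cs x ≡ p × (∀ z → Uof cs x z ≡ C z)

    listed-member : ∀ p {c} → Listed p ≡ true → c ∈ (p , U p) ∷ Removals p (count (U p) ≡ᵇ 3) →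
                    c ∈ candidatesOf D F p
    listed-member p listed m = subst (λ b → _ ∈ (if b then (p , U p) ∷ Removals p (count (U p) ≡ᵇ 3) else [])) (sym listed) m

    listed-candidate : ∀ p C → (p , C) ∈ candidatesOf D F p → Candidate-for p C
    listed-candidate p C m = index m′ , cong proj₁ found , λ z → cong (λ c → proj₂ c z) found
      where
      m′ = ∈-concatMap⁺ (candidatesOf D F) {xs = allFin n} (lose (∈-allFin p) m)
      found : lookup cs (index m′) ≡ (p , C)
      found = sym (lookup-index m′)

    candidate-cong : ∀ {p C C′} → (∀ z → C z ≡ C′ z) → Candidate-for p C → Candidate-for p C′
    candidate-cong C≗C′ (x , node , Ux≗C) = x , node , λ z → trans (Ux≗C z) (C≗C′ z)

    candidate-complete : ∀ p (C : Fin n → Bool) → outdeg0 F p ≡ true → count (U p) ≤ 3 →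
                         2 ≤ count C → (∀ z → C z ≡ true → U p z ≡ true) → Candidate-for p C
    candidate-complete p C out ≤3 ≥2 C⊆U with count (U p) ≤? count C
    ... | yes U≤C = candidate-cong (λ z → true⇔⇒≡ (count-mono-≥⇒⊇ C⊆U U≤C z) (C⊆U z))
                      (listed-candidate p (U p) (listed-member p listed (here refl)))
      where listed = Listed⁺ p out (≤-trans ≥2 (count-mono C⊆U)) ≤3
    ... | no U≰C with count-mono-<⇒∃ C⊆U (≰⇒> U≰C)
    ...   | u , Uu , Cu = candidate-cong (λ z → true⇔⇒≡ (count-mono-≥⇒⊇ C⊆U′ U′≤C z) (C⊆U′ z))
                            (listed-candidate p U′ (listed-member p listed (there (subst (λ b → (p , U′) ∈ Removals p b) (sym is-3) removal))))
      where
      listed = Listed⁺ p out (≤-trans ≥2 (count-mono C⊆U)) ≤3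
      U′ : Fin n → Bool
      U′ = proj₂ (one-removed p u)
      C⊆U′ : ∀ z → C z ≡ true → U′ z ≡ true
      C⊆U′ z Cz = ∧-true⁺ (C⊆U z Cz) (cong not (≢true⇒≡false λ z=u → true≢false Cz (subst (λ w → C w ≡ false) (sym (==⇒≡ z=u)) Cu)))
      U≡U′+1 : count (U p) ≡ 1 + count U′
      U≡U′+1 = trans (count-split (U p) (_== u)) (cong (_+ count U′)
                 (count-≡1 _ u (∧-true⁺ Uu (==-refl u)) λ x y hx hy → trans (==⇒≡ (proj₂ (∧-true⁻ {U p x} hx))) (sym (==⇒≡ (proj₂ (∧-true⁻ {U p y} hy))))))
      U′≤C : count U′ ≤ count C
      U′≤C = ≤-trans (s≤s⁻¹ (subst (_≤ 3) U≡U′+1 ≤3)) ≥2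
      is-3 : (count (U p) ≡ᵇ 3) ≡ true
      is-3 = T⇒true (≡⇒≡ᵇ _ 3 (≤-antisym ≤3 (≤-trans (s≤s ≥2) (≰⇒> U≰C))))
      removal : (p , U′) ∈ map (one-removed p) (filterᵇ (U p) (allFin n))
      removal = ∈-map⁺ (one-removed p) (∈-filter⁺ (T? ∘ U p) (∈-allFin u) (true⇒T Uu))

  module Arborescence {D T : Digraph n} (dag : IsDag D) (T-spanning : IsSpanningArborescenceOf D T) where

    T⊆D : T ⊆ᴬ D
    T⊆D = proj₁ T-spanning

    root : Fin n
    root = proj₁ (proj₂ T-spanning)

    unique-paths : IsArborescence T root
    unique-paths = proj₂ (proj₂ T-spanning)

    parent-exists : ∀ u → ¬ root ≡ u → ∃ λ p → T p u ≡ true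
    parent-exists u root≢u with proj₁ (unique-paths u)
    ... | _ , w , _ = last-arc (walk⇒Reaches w)
      where
      last-arc : Reaches T root u → ∃ λ p → T p u ≡ true
      last-arc ε = ⊥-elim (root≢u refl)
      last-arc (_ ▸ e) = _ , e

    path-through : ∀ {p u} → T p u ≡ true → ∃ λ xs → DirPath T root u (xs ++ u ∷ []) × Walk T root p xs
    path-through {p} {u} e with proj₁ (unique-paths p)
    ... | xs , w , uniq = xs , (walk-snoc w e , unique-snoc uniq u∉xs) , w
      where
      u∉xs : u ∉ xs
      u∉xs u∈xs with walk-suffix w u∈xs uniq
      ... | _ , w′ , _ with walk⇒dirPath (walk-mono T⊆D w′)
      ... | ys , cycle = dag p u ys (T⊆D p u e) cycle

    indeg≤1 : ∀ {p q u} → T p u ≡ true → T q u ≡ true → p ≡ q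
    indeg≤1 e e′ with path-through e | path-through e′
    ... | xs , P , w | ys , P′ , w′ with ∷ʳ-injective xs ys (proj₂ (unique-paths _) _ _ P P′)
    ... | refl , _ with walk-ends-with w | walk-ends-with w′
    ... | zs , refl | zs′ , eq = proj₂ (∷ʳ-injective zs zs′ eq)

  -- Leaves of a spanning arborescence versus an independent set of candidates

  module LeafBound {D F T : Digraph n} (dag : IsDag D) (T-spanning : IsSpanningArborescenceOf D T)
    (covered : ∀ {v u} → outdeg0 F v ≡ false → D v u ≡ true → indeg0 F u ≡ false)
    (settled : ∀ v → outdeg0 F v ≡ true → count (Uset D F v) ≤ 3) where

    open Arborescence dag T-spanning
    open CandidateSets D F

    RootChild : Fin n → Fin n → Bool
    RootChild p u = T p u ∧ indeg0 F u

    rootChildren : Fin n → ℕ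
    rootChildren p = count (RootChild p)

    X : Set
    X = Fin (length cs)

    Good : X → Bool
    Good x = all (λ z → not (Uof cs x z xor RootChild (nodeOf cs x) z)) (allFin n)

    Chosen : X → Bool
    Chosen x = Good x ∧ IsFirst (λ y → Good y ∧ (nodeOf cs y == nodeOf cs x)) x

    Good⇒≗ : ∀ {x} → Good x ≡ true → ∀ z → Uof cs x z ≡ RootChild (nodeOf cs x) z
    Good⇒≗ good z = xnor⇒≡ (all-allFin⁻ _ good z)

    chosen-independent : Independent cs Chosen
    chosen-independent x y x≢y chosen chosen′ with ∧-true⁻ {Good x} chosen | ∧-true⁻ {Good y} chosen′
    ... | good , first | good′ , first′ with nodeOf cs x ≟ᶠ nodeOf cs y
    ... | yes same = ⊥-elim (x≢y (toℕ-injective (≤-antisym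
          (IsFirst-minimal first (∧-true⁺ good′ (subst (λ v → nodeOf cs y == v ≡ true) (sym same) (==-refl _))))
          (IsFirst-minimal first′ (∧-true⁺ good (subst (λ v → nodeOf cs x == v ≡ true) same (==-refl _)))))))
    ... | no different = count-none _ λ z → ≢true⇒≡false λ both → different (indeg≤1
          (proj₁ (∧-true⁻ {T (nodeOf cs x) z} (trans (sym (Good⇒≗ good z)) (proj₁ (∧-true⁻ {Uof cs x z} both)))))
          (proj₁ (∧-true⁻ {T (nodeOf cs y) z} (trans (sym (Good⇒≗ good′ z)) (proj₂ (∧-true⁻ {Uof cs x z} both))))))

    chosen-for : ∀ p → 2 ≤ rootChildren p →
                 ∃ λ a → Chosen a ≡ true × nodeOf cs a ≡ p × weight cs a ≡ rootChildren p ∸ 1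
    chosen-for p ≥2 with count-witness (RootChild p) (≤-trans (s≤s z≤n) ≥2)
    ... | u , child with ∧-true⁻ {T p u} child
    ... | Tpu , root-u with candidate-complete p (RootChild p) out (settled p out) ≥2 child⇒U
      where
      out : outdeg0 F p ≡ true
      out = ≢false⇒≡true λ o → true≢false root-u (covered o (T⊆D p u Tpu))
      child⇒U : ∀ z → RootChild p z ≡ true → Uset D F p z ≡ true
      child⇒U z h = ∧-true⁺ (proj₂ (∧-true⁻ {T p z} h)) (T⊆D p z (proj₁ (∧-true⁻ {T p z} h)))
    ... | x₀ , node₀ , U≗ with minimum (λ y → Good y ∧ (nodeOf cs y == p)) x₀ (∧-true⁺ good₀ (subst (λ v → v == p ≡ true) (sym node₀) (==-refl p)))
      where
      good₀ : Good x₀ ≡ true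
      good₀ = all-allFin⁺ _ λ z → ≡⇒xnor (trans (U≗ z) (cong (λ v → RootChild v z) (sym node₀)))
    ... | a , qa , below with ∧-true⁻ {Good a} qa
    ... | good , a-at-p with ==⇒≡ a-at-p
    ... | refl = a , ∧-true⁺ good (IsFirst-intro below) , refl ,
                 cong (_∸ 1) (count-cong (Good⇒≗ good))

    excess≤weight : ∑[ p < n ] (rootChildren p ∸ 1) ≤ totalWeight cs Chosen
    excess≤weight = begin
      ∑[ p < n ] (rootChildren p ∸ 1)                                ≤⟨ ∑-mono-≤ excess≤chosen ⟩
      ∑[ p < n ] ∑[ x < length cs ] chosen-at p x                    ≡⟨ ∑-comm chosen-at ⟩
      ∑[ x < length cs ] ∑[ p < n ] chosen-at p x                    ≡⟨ sum-cong-≗ (λ x → ∑-if-single (Chosen x) (nodeOf cs x) (weight cs x)) ⟩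
      ∑[ x < length cs ] (if Chosen x then weight cs x else 0)       ≡⟨ sum-map-tabulate (λ x → if Chosen x then weight cs x else 0) (λ x → x) ⟨
      totalWeight cs Chosen                                          ∎
      where
      open ≤-Reasoning
      chosen-at : Fin n → X → ℕ
      chosen-at p x = if Chosen x ∧ (nodeOf cs x == p) then weight cs x else 0
      excess≤chosen : ∀ p → rootChildren p ∸ 1 ≤ ∑[ x < length cs ] chosen-at p x
      excess≤chosen p with 2 ≤? rootChildren p
      ... | no <2 = ≤-trans (≤-reflexive (m≤n⇒m∸n≡0 (s≤s⁻¹ (≰⇒> <2)))) z≤n
      ... | yes ≥2 =
        let a , chosen , at-p , w≡ = chosen-for p ≥2
            at-a : chosen-at p a ≡ weight cs a
            at-a = cong (if_then weight cs a else 0) (∧-true⁺ chosen (subst (λ v → nodeOf cs a == v ≡ true) at-p (==-refl _)))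
        in ≤-trans (≤-reflexive (trans (sym w≡) (sym at-a))) (term≤∑ (chosen-at p) a)

    roots≤1+children : count (indeg0 F) ≤ 1 + ∑[ p < n ] rootChildren p
    roots≤1+children = begin
      count (indeg0 F)                                                    ≡⟨ count≡∑𝟙 (indeg0 F) ⟩
      ∑[ u < n ] 𝟙 (indeg0 F u)                                           ≤⟨ ∑-mono-≤ root-or-child ⟩
      ∑[ u < n ] (𝟙 (root == u) + ∑[ p < n ] 𝟙 (RootChild p u))          ≡⟨ ∑-distrib-+ (λ u → 𝟙 (root == u)) _ ⟩
      ∑[ u < n ] 𝟙 (root == u) + ∑[ u < n ] ∑[ p < n ] 𝟙 (RootChild p u)
        ≡⟨ cong₂ _+_ (trans (sym (count≡∑𝟙 (root ==_))) (count-== root)) (∑-comm (λ u p → 𝟙 (RootChild p u))) ⟩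
      1 + ∑[ p < n ] ∑[ u < n ] 𝟙 (RootChild p u)                         ≡⟨ cong (1 +_) (sum-cong-≗ (λ p → count≡∑𝟙 (RootChild p))) ⟨
      1 + ∑[ p < n ] rootChildren p                                       ∎
      where
      open ≤-Reasoning
      root-or-child : ∀ u → 𝟙 (indeg0 F u) ≤ 𝟙 (root == u) + ∑[ p < n ] 𝟙 (RootChild p u)
      root-or-child u with root ≟ᶠ u | indeg0 F u ≟ᵇ true
      ... | yes _ | _ = ≤-trans (𝟙≤1 _) (m≤m+n 1 _)
      ... | no _ | no nonroot = ≤-trans (≤-reflexive (cong 𝟙 (≢true⇒≡false nonroot))) z≤n
      ... | no root≢u | yes root-u with parent-exists u root≢u
      ...   | p , Tpu = subst (_≤ _) (cong 𝟙 (trans (∧-true⁺ Tpu root-u) (sym root-u))) (term≤∑ (λ p → 𝟙 (RootChild p u)) p)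

    children≤internal+excess :
      ∑[ p < n ] rootChildren p ≤ count (not ∘ outdeg0 T) + ∑[ p < n ] (rootChildren p ∸ 1)
    children≤internal+excess = begin
      ∑[ p < n ] rootChildren p                                           ≤⟨ ∑-mono-≤ internal-or-excess ⟩
      ∑[ p < n ] (𝟙 (not (outdeg0 T p)) + (rootChildren p ∸ 1))           ≡⟨ ∑-distrib-+ (𝟙 ∘ not ∘ outdeg0 T) _ ⟩
      ∑[ p < n ] 𝟙 (not (outdeg0 T p)) + ∑[ p < n ] (rootChildren p ∸ 1) ≡⟨ cong (_+ ∑[ p < n ] (rootChildren p ∸ 1)) (count≡∑𝟙 (not ∘ outdeg0 T)) ⟨
      count (not ∘ outdeg0 T) + ∑[ p < n ] (rootChildren p ∸ 1)           ∎
      where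
      open ≤-Reasoning
      internal-or-excess : ∀ p → rootChildren p ≤ 𝟙 (not (outdeg0 T p)) + (rootChildren p ∸ 1)
      internal-or-excess p with rootChildren p in k
      ... | zero = z≤n
      ... | suc _ with count-witness (RootChild p) (subst (1 ≤_) (sym k) (s≤s z≤n))
      ...   | u , child = ≤-reflexive (cong (λ b → 𝟙 (not b) + _)
                            (sym (arc⇒¬outdeg0 T (proj₁ (∧-true⁻ {T p u} child)))))

    leaves≤nonroots+1+weight : leaves T ≤ nonroots F + 1 + totalWeight cs Chosen
    leaves≤nonroots+1+weight = +-cancelʳ-≤ I L (M + 1 + W) (begin
      L + I                  ≡⟨ trans (count-complement (outdeg0 T)) (sym (count-complement (indeg0 F))) ⟩
      R + M                  ≤⟨ +-monoˡ-≤ M (≤-trans roots≤1+children (+-monoʳ-≤ 1 children≤internal+excess)) ⟩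
      1 + (I + S) + M        ≡⟨ solve 4 (λ I S M W → con 1 :+ (I :+ S) :+ M := M :+ con 1 :+ S :+ I) refl I S M W ⟩
      M + 1 + S + I          ≤⟨ +-monoˡ-≤ I (+-monoʳ-≤ (M + 1) excess≤weight) ⟩
      M + 1 + W + I          ∎)
      where
      open ≤-Reasoning
      open +-*-Solver
      L = leaves T
      I = count (not ∘ outdeg0 T)
      R = count (indeg0 F)
      M = nonroots F
      S = ∑[ p < n ] (rootChildren p ∸ 1)
      W = totalWeight cs Chosen

  six-weights≤ : ∀ k → k ≤ 3 → 6 * (k ∸ 1) ≤ (if k ∸ 1 ≡ᵇ 2 then k else 0) + 3 * k
  six-weights≤ 0 _ = z≤n
  six-weights≤ 1 _ = z≤n
  six-weights≤ 2 _ = ≤-refl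
  six-weights≤ 3 _ = ≤-refl
  six-weights≤ (suc (suc (suc (suc _)))) (s≤s (s≤s (s≤s ())))

  -- Adding the arcs of an independent set of candidates

  module AddArcs {D F : Digraph n} (dag : IsDag D) (F⊆D : F ⊆ᴬ D)
    (F-indeg≤1 : ∀ {a b c} → F a c ≡ true → F b c ≡ true → a ≡ b)
    (I : VSubset (Candidates D F)) (I-independent : Independent (Candidates D F) I) where

    open CandidateSets D F

    U-root : ∀ x {z} → Uof cs x z ≡ true → indeg0 F z ≡ true
    U-root x Uz = proj₁ (∧-true⁻ (proj₁ (candidate-sound x) _ Uz))

    U-arc : ∀ x {z} → Uof cs x z ≡ true → D (nodeOf cs x) z ≡ true
    U-arc x {z} Uz = proj₂ (∧-true⁻ {indeg0 F z} (proj₁ (candidate-sound x) _ Uz))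

    I-disjoint : ∀ {x y z} → I x ≡ true → I y ≡ true → Uof cs x z ≡ true → Uof cs y z ≡ true → x ≡ y
    I-disjoint {x} {y} {z} Ix Iy Uxz Uyz with x ≟ᶠ y
    ... | yes x≡y = x≡y
    ... | no x≢y = ⊥-elim (<-irrefl (sym (I-independent x y x≢y Ix Iy)) (count-pos _ z (∧-true⁺ Uxz Uyz)))

    module Selection (sel : Fin (length cs) → Bool) where

      Fₛ : Digraph n
      Fₛ = addArcs (Candidates D F) F I sel

      Picked : Fin (length cs) → Bool
      Picked x = I x ∧ sel x

      NewArc : Fin n → Fin n → Fin (length cs) → Bool
      NewArc a b x = I x ∧ sel x ∧ (nodeOf cs x == a) ∧ Uof cs x b

      F⊆Fₛ : F ⊆ᴬ Fₛ
      F⊆Fₛ a b e = ∨-trueˡ _ e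

      new-arc : ∀ x {z} → Picked x ≡ true → Uof cs x z ≡ true → Fₛ (nodeOf cs x) z ≡ true
      new-arc x {z} picked Uz with ∧-true⁻ {I x} picked
      ... | Ix , sx = ∨-trueʳ (F (nodeOf cs x) z)
        (any-allFin⁺ (NewArc (nodeOf cs x) z) x (∧-true⁺ Ix (∧-true⁺ sx (∧-true⁺ (==-refl _) Uz))))

      addArcs⁻ : ∀ {a b} → Fₛ a b ≡ true →
                 F a b ≡ true ⊎ ∃ λ x → I x ≡ true × nodeOf cs x ≡ a × Uof cs x b ≡ true
      addArcs⁻ {a} {b} e with ∨-true⁻ {F a b} e
      ... | inj₁ old = inj₁ old
      ... | inj₂ new with any-allFin⁻ (NewArc a b) new
      ... | x , h with ∧-true⁻ {I x} h
      ... | Ix , h′ with ∧-true⁻ (proj₂ (∧-true⁻ {sel x} h′))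
      ... | at-a , Ub = inj₂ (x , Ix , ==⇒≡ at-a , Ub)

      Fₛ⊆D : Fₛ ⊆ᴬ D
      Fₛ⊆D a b e with addArcs⁻ e
      ... | inj₁ old = F⊆D a b old
      ... | inj₂ (x , _ , refl , Ub) = U-arc x Ub

      Fₛ-indeg≤1 : ∀ {a b c} → Fₛ a c ≡ true → Fₛ b c ≡ true → a ≡ b
      Fₛ-indeg≤1 {a} {b} e e′ with addArcs⁻ e | addArcs⁻ e′
      ... | inj₁ old | inj₁ old′ = F-indeg≤1 old old′
      ... | inj₁ old | inj₂ (y , _ , _ , Uy) = ⊥-elim (true≢false old (indeg0⇒no-arc F (U-root y Uy) a))
      ... | inj₂ (x , _ , _ , Ux) | inj₁ old′ = ⊥-elim (true≢false old′ (indeg0⇒no-arc F (U-root x Ux) b))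
      ... | inj₂ (x , Ix , refl , Ux) | inj₂ (y , Iy , refl , Uy) = cong (nodeOf cs) (I-disjoint Ix Iy Ux Uy)

      Fₛ-branching : IsBranching Fₛ
      Fₛ-branching = record { acyclic = dag-subgraph-acyclic dag Fₛ⊆D ; indeg≤1 = Fₛ-indeg≤1 }

      Covered : Fin n → Bool
      Covered z = any (λ x → Picked x ∧ Uof cs x z) (allFin (length cs))

      picked-size : Fin (length cs) → ℕ
      picked-size x = if Picked x then count (Uof cs x) else 0

      picked≤covered : ∑[ x < length cs ] picked-size x ≤ count Covered
      picked≤covered = begin
        ∑[ x < length cs ] picked-size x                                  ≡⟨ sum-cong-≗ size≡count ⟩
        ∑[ x < length cs ] ∑[ z < n ] 𝟙 (Picked x ∧ Uof cs x z)           ≡⟨ ∑-comm (λ x z → 𝟙 (Picked x ∧ Uof cs x z)) ⟩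
        ∑[ z < n ] ∑[ x < length cs ] 𝟙 (Picked x ∧ Uof cs x z)           ≤⟨ ∑-mono-≤ at-most-once ⟩
        ∑[ z < n ] 𝟙 (Covered z)                                          ≡⟨ count≡∑𝟙 Covered ⟨
        count Covered                                                     ∎
        where
        open ≤-Reasoning
        size≡count : ∀ x → picked-size x ≡ ∑[ z < n ] 𝟙 (Picked x ∧ Uof cs x z)
        size≡count x with Picked x
        ... | true = count≡∑𝟙 (Uof cs x)
        ... | false = sym (sum-replicate-zero n)
        at-most-once : ∀ z → ∑[ x < length cs ] 𝟙 (Picked x ∧ Uof cs x z) ≤ 𝟙 (Covered z)
        at-most-once z with Covered z ≟ᵇ true
        ... | yes covered = subst₂ _≤_ (count≡∑𝟙 (λ x → Picked x ∧ Uof cs x z)) (cong 𝟙 (sym covered)) (count-≤1 _ λ x y hx hy →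
              I-disjoint (proj₁ (∧-true⁻ (proj₁ (∧-true⁻ {Picked x} hx)))) (proj₁ (∧-true⁻ (proj₁ (∧-true⁻ {Picked y} hy))))
                         (proj₂ (∧-true⁻ {Picked x} hx)) (proj₂ (∧-true⁻ {Picked y} hy)))
        ... | no uncovered = ≤-trans (≤-reflexive (trans (sym (count≡∑𝟙 (λ x → Picked x ∧ Uof cs x z))) (count-none _ λ x →
              ≢true⇒≡false λ h → uncovered (any-allFin⁺ (λ x → Picked x ∧ Uof cs x z) x h)))) z≤n

      nonroots-grow : nonroots F + ∑[ x < length cs ] picked-size x ≤ nonroots Fₛ
      nonroots-grow = begin
        nonroots F + ∑[ x < length cs ] picked-size x  ≤⟨ +-monoʳ-≤ _ picked≤covered ⟩
        nonroots F + count Covered                      ≤⟨ count-disjoint-∨ _ Covered covered-root ⟩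
        count (λ z → not (indeg0 F z) ∨ Covered z)      ≤⟨ count-mono covered⇒nonroot ⟩
        nonroots Fₛ                                     ∎
        where
        open ≤-Reasoning
        covered-witness : ∀ {z} → Covered z ≡ true → ∃ λ x → Picked x ≡ true × Uof cs x z ≡ true
        covered-witness {z} c with any-allFin⁻ _ c
        ... | x , h = x , ∧-true⁻ {Picked x} h
        covered-root : ∀ z → not (indeg0 F z) ≡ true → Covered z ≡ true → ⊥
        covered-root z nonroot c with covered-witness c
        ... | x , _ , Uz = true≢false (U-root x Uz) (not-true⁻ nonroot)
        covered⇒nonroot : ∀ z → not (indeg0 F z) ∨ Covered z ≡ true → not (indeg0 Fₛ z) ≡ true
        covered⇒nonroot z h with ∨-true⁻ {not (indeg0 F z)} h
        ... | inj₁ nonroot = cong not (¬indeg0-mono F⊆Fₛ (not-true⁻ nonroot))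
        ... | inj₂ c with covered-witness c
        ...   | x , picked , Uz = cong not (arc⇒¬indeg0 Fₛ (new-arc x picked Uz))

    -- Here and in Fₛ we write Candidates D F rather than cs: this keeps the digraphs syntactically
    -- equal to those of the theorem, whose comparison would otherwise unfold counts and sums.
    module F₂ = Selection (λ x → weight (Candidates D F) x ≡ᵇ 2)
    module F₃ = Selection (λ _ → true)

    six-weights-≤-picked : 6 * totalWeight cs I ≤ ∑[ x < length cs ] F₂.picked-size x + 3 * ∑[ x < length cs ] F₃.picked-size x
    six-weights-≤-picked = begin
      6 * totalWeight cs I                                                    ≡⟨ cong (6 *_) (sum-map-tabulate weighted (λ x → x)) ⟩
      6 * ∑[ x < length cs ] (if I x then weight cs x else 0)                 ≡⟨ *-distribˡ-sum 6 weighted ⟩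
      ∑[ x < length cs ] (6 * (if I x then weight cs x else 0))               ≤⟨ ∑-mono-≤ pointwise ⟩
      ∑[ x < length cs ] (F₂.picked-size x + 3 * F₃.picked-size x)            ≡⟨ ∑-distrib-+ F₂.picked-size _ ⟩
      ∑[ x < length cs ] F₂.picked-size x + ∑[ x < length cs ] (3 * F₃.picked-size x)
        ≡⟨ cong (∑[ x < length cs ] F₂.picked-size x +_) (*-distribˡ-sum 3 F₃.picked-size) ⟨
      ∑[ x < length cs ] F₂.picked-size x + 3 * ∑[ x < length cs ] F₃.picked-size x ∎
      where
      open ≤-Reasoning
      weighted : Fin (length cs) → ℕ
      weighted x = if I x then weight cs x else 0
      pointwise : ∀ x → 6 * (if I x then weight cs x else 0) ≤ F₂.picked-size x + 3 * F₃.picked-size x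
      pointwise x with I x
      ... | false = z≤n
      ... | true = six-weights≤ (count (Uof cs x)) (proj₂ (candidate-sound x))

    nonroots-bound : 4 * nonroots F + 6 * totalWeight (Candidates D F) I ≤ nonroots F₂.Fₛ + 3 * nonroots F₃.Fₛ
    nonroots-bound = begin
      4 * m₁ + 6 * totalWeight cs I      ≤⟨ +-monoʳ-≤ (4 * m₁) six-weights-≤-picked ⟩
      4 * m₁ + (P₂ + 3 * P₃)             ≡⟨ solve 3 (λ m P Q → con 4 :* m :+ (P :+ con 3 :* Q) := (m :+ P) :+ con 3 :* (m :+ Q)) refl m₁ P₂ P₃ ⟩
      (m₁ + P₂) + 3 * (m₁ + P₃)          ≤⟨ +-mono-≤ F₂.nonroots-grow (*-monoʳ-≤ 3 F₃.nonroots-grow) ⟩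
      nonroots F₂.Fₛ + 3 * nonroots F₃.Fₛ ∎
      where
      open ≤-Reasoning
      open +-*-Solver
      m₁ = nonroots F
      P₂ = ∑[ x < length cs ] F₂.picked-size x
      P₃ = ∑[ x < length cs ] F₃.picked-size x

open Combinatorics
  using (nonroots; IsBranching; module Branching; module Greedy; module AddArcs; module LeafBound)
open import Data.Bool using (true; false; not)
open import Data.Fin using (Fin)
open import Data.Integer as ℤ using (+_; +≤+)
import Data.Integer.Properties as ℤ
open import Data.List using (List; allFin; length)
open import Data.List.Relation.Binary.Permutation.Propositional using (_↭_)
open import Data.Nat as ℕ using (ℕ; _≡ᵇ_)
import Data.Nat.Properties as ℕ
open import Data.Nat.Coprimality using (1-coprimeTo) renaming (sym to coprime-sym)
open import Data.Rational using (ℚ; mkℚ; _≤_; _+_; _-_; _*_; _/_; 0ℚ; 1ℚ; *≤*; toℚᵘ)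
open import Data.Rational.Properties
  using (≤-trans; ≤-reflexive; +-monoʳ-≤; +-identityʳ; module ≤-Reasoning; normalize-coprime; toℚᵘ-injective; toℚᵘ-homo-+; toℚᵘ-homo-*;
         nonNegative⁻¹; nonNeg*nonNeg⇒nonNeg)
open import Data.Rational.Base using (nonNegative)
open import Data.Rational.Solver using (module +-*-Solver)
import Data.Rational.Unnormalised as ℚᵘ
import Data.Rational.Unnormalised.Properties as ℚᵘ
open import Relation.Binary.PropositionalEquality

ℕ→ℚ≡mkℚ : ∀ k → ℕ→ℚ k ≡ mkℚ (+ k) 0 (coprime-sym (1-coprimeTo k))
ℕ→ℚ≡mkℚ k = normalize-coprime (coprime-sym (1-coprimeTo k))

toℚᵘ-ℕ→ℚ : ∀ k → toℚᵘ (ℕ→ℚ k) ≡ ℚᵘ.mkℚᵘ (+ k) 0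
toℚᵘ-ℕ→ℚ k = cong toℚᵘ (ℕ→ℚ≡mkℚ k)

ℕ→ℚ-+ : ∀ a b → ℕ→ℚ (a ℕ.+ b) ≡ ℕ→ℚ a + ℕ→ℚ b
ℕ→ℚ-+ a b = toℚᵘ-injective (ℚᵘ.≃-trans (ℚᵘ.*≡* eq) (ℚᵘ.≃-sym (toℚᵘ-homo-+ (ℕ→ℚ a) (ℕ→ℚ b))))
  where
  eq : ℚᵘ.↥ (toℚᵘ (ℕ→ℚ (a ℕ.+ b))) ℤ.* ℚᵘ.↧ (toℚᵘ (ℕ→ℚ a) ℚᵘ.+ toℚᵘ (ℕ→ℚ b)) ≡
       ℚᵘ.↥ (toℚᵘ (ℕ→ℚ a) ℚᵘ.+ toℚᵘ (ℕ→ℚ b)) ℤ.* ℚᵘ.↧ (toℚᵘ (ℕ→ℚ (a ℕ.+ b)))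
  eq rewrite toℚᵘ-ℕ→ℚ (a ℕ.+ b) | toℚᵘ-ℕ→ℚ a | toℚᵘ-ℕ→ℚ b
           | ℤ.*-identityʳ (+ a) | ℤ.*-identityʳ (+ b) | ℤ.*-identityʳ (+ (a ℕ.+ b)) = ℤ.pos-+ a b

ℕ→ℚ-* : ∀ a b → ℕ→ℚ (a ℕ.* b) ≡ ℕ→ℚ a * ℕ→ℚ b
ℕ→ℚ-* a b = toℚᵘ-injective (ℚᵘ.≃-trans (ℚᵘ.*≡* eq) (ℚᵘ.≃-sym (toℚᵘ-homo-* (ℕ→ℚ a) (ℕ→ℚ b))))
  where
  eq : ℚᵘ.↥ (toℚᵘ (ℕ→ℚ (a ℕ.* b))) ℤ.* ℚᵘ.↧ (toℚᵘ (ℕ→ℚ a) ℚᵘ.* toℚᵘ (ℕ→ℚ b)) ≡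
       ℚᵘ.↥ (toℚᵘ (ℕ→ℚ a) ℚᵘ.* toℚᵘ (ℕ→ℚ b)) ℤ.* ℚᵘ.↧ (toℚᵘ (ℕ→ℚ (a ℕ.* b)))
  eq rewrite toℚᵘ-ℕ→ℚ (a ℕ.* b) | toℚᵘ-ℕ→ℚ a | toℚᵘ-ℕ→ℚ b
           | ℤ.*-identityʳ (+ (a ℕ.* b)) | ℤ.*-identityʳ (+ a ℤ.* + b) = ℤ.pos-* a b

ℕ→ℚ-mono : ∀ {a b} → a ℕ.≤ b → ℕ→ℚ a ≤ ℕ→ℚ b
ℕ→ℚ-mono {a} {b} a≤b rewrite ℕ→ℚ≡mkℚ a | ℕ→ℚ≡mkℚ b =
  *≤* (subst₂ ℤ._≤_ (sym (ℤ.*-identityʳ (+ a))) (sym (ℤ.*-identityʳ (+ b))) (+≤+ a≤b))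

ℕ→ℚ-difference : ∀ {N K m} → N ≡ K ℕ.+ m → ℕ→ℚ N - ℕ→ℚ K ≡ ℕ→ℚ m
ℕ→ℚ-difference {K = K} {m} refl =
  trans (cong (_- ℕ→ℚ K) (ℕ→ℚ-+ K m)) (solve 2 (λ k m → (k :+ m) :- k := m) refl (ℕ→ℚ K) (ℕ→ℚ m))
  where open +-*-Solver

0≤-* : ∀ {p q} → 0ℚ ≤ p → 0ℚ ≤ q → 0ℚ ≤ p * q
0≤-* {p} {q} 0≤p 0≤q = nonNegative⁻¹ (p * q) {{nonNeg*nonNeg⇒nonNeg p {{nonNegative 0≤p}} q {{nonNegative 0≤q}}}}

-- The right-hand side exceeds m₁ + 1 + α W by (α/6)(m₂ + 3 m₃ − 4 m₁ − 6 W) ≥ 0.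
weighted-bound : ∀ (α : ℚ) → 1ℚ ≤ α → ∀ {L W′} W m₁ m₂ m₃ →
  L ℕ.≤ m₁ ℕ.+ 1 ℕ.+ W′ → ℕ→ℚ W′ ≤ α * ℕ→ℚ W → 4 ℕ.* m₁ ℕ.+ 6 ℕ.* W ℕ.≤ m₂ ℕ.+ 3 ℕ.* m₃ →
  ℕ→ℚ L ≤ ((+ 3 / 1) - (+ 2 / 1) * α) * (+ 1 / 3) * ℕ→ℚ m₁ + α * (+ 1 / 6) * ℕ→ℚ m₂ + α * (+ 1 / 2) * ℕ→ℚ m₃ + 1ℚ
weighted-bound α 1≤α {L} {W′} W m₁ m₂ m₃ L≤ W′≤ A≤B = begin
  ℕ→ℚ L                                          ≤⟨ ℕ→ℚ-mono {L} {m₁ ℕ.+ 1 ℕ.+ W′} L≤ ⟩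
  ℕ→ℚ (m₁ ℕ.+ 1 ℕ.+ W′)                          ≡⟨ trans (ℕ→ℚ-+ (m₁ ℕ.+ 1) W′) (cong (_+ ℕ→ℚ W′) (ℕ→ℚ-+ m₁ 1)) ⟩
  q₁ + 1ℚ + ℕ→ℚ W′                               ≤⟨ +-monoʳ-≤ (q₁ + 1ℚ) W′≤ ⟩
  q₁ + 1ℚ + α * w                                ≡⟨ +-identityʳ _ ⟨
  q₁ + 1ℚ + α * w + 0ℚ                           ≤⟨ +-monoʳ-≤ (q₁ + 1ℚ + α * w) (0≤-* (0≤-* 0≤α (*≤* (+≤+ ℕ.z≤n))) (ℕ→ℚ-mono {0} {B ℕ.∸ A} ℕ.z≤n)) ⟩
  q₁ + 1ℚ + α * w + α * (+ 1 / 6) * d            ≡⟨ cong (λ x → q₁ + 1ℚ + α * w + α * (+ 1 / 6) * x) d≡ ⟩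
  q₁ + 1ℚ + α * w + α * (+ 1 / 6) * ((q₂ + (+ 3 / 1) * q₃) - ((+ 4 / 1) * q₁ + (+ 6 / 1) * w))
                                                 ≡⟨ solve 5 (λ α q₁ q₂ q₃ w →
      q₁ :+ con 1ℚ :+ α :* w :+ α :* con (+ 1 / 6) :* ((q₂ :+ con (+ 3 / 1) :* q₃) :- (con (+ 4 / 1) :* q₁ :+ con (+ 6 / 1) :* w))
      := (con (+ 3 / 1) :- con (+ 2 / 1) :* α) :* con (+ 1 / 3) :* q₁ :+ α :* con (+ 1 / 6) :* q₂
         :+ α :* con (+ 1 / 2) :* q₃ :+ con 1ℚ) refl α q₁ q₂ q₃ w ⟩
  ((+ 3 / 1) - (+ 2 / 1) * α) * (+ 1 / 3) * q₁ + α * (+ 1 / 6) * q₂ + α * (+ 1 / 2) * q₃ + 1ℚ ∎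
  where
  open ≤-Reasoning
  open +-*-Solver
  q₁ = ℕ→ℚ m₁
  q₂ = ℕ→ℚ m₂
  q₃ = ℕ→ℚ m₃
  w = ℕ→ℚ W
  A = 4 ℕ.* m₁ ℕ.+ 6 ℕ.* W
  B = m₂ ℕ.+ 3 ℕ.* m₃
  d = ℕ→ℚ (B ℕ.∸ A)
  0≤α : 0ℚ ≤ α
  0≤α = ≤-trans (ℕ→ℚ-mono {0} {1} ℕ.z≤n) 1≤α
  d≡ : d ≡ (q₂ + (+ 3 / 1) * q₃) - ((+ 4 / 1) * q₁ + (+ 6 / 1) * w)
  d≡ = begin-equality
    d                                    ≡⟨ ℕ→ℚ-difference {B} {A} {B ℕ.∸ A} (sym (ℕ.m+[n∸m]≡n {A} {B} A≤B)) ⟨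
    ℕ→ℚ B - ℕ→ℚ A                        ≡⟨ cong₂ _-_ (trans (ℕ→ℚ-+ m₂ (3 ℕ.* m₃)) (cong (λ x → q₂ + x) (ℕ→ℚ-* 3 m₃)))
                                                       (trans (ℕ→ℚ-+ (4 ℕ.* m₁) (6 ℕ.* W)) (cong₂ _+_ (ℕ→ℚ-* 4 m₁) (ℕ→ℚ-* 6 W))) ⟩
    (q₂ + (+ 3 / 1) * q₃) - ((+ 4 / 1) * q₁ + (+ 6 / 1) * w) ∎

branchings-leaf-bound : ∀ (α : ℚ) → 1ℚ ≤ α → ∀ {n} {F₁ F₂ F₃ : Digraph n} {L} W′ W →
  IsBranching F₁ → IsBranching F₂ → IsBranching F₃ →
  L ℕ.≤ nonroots F₁ ℕ.+ 1 ℕ.+ W′ → ℕ→ℚ W′ ≤ α * ℕ→ℚ W →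
  4 ℕ.* nonroots F₁ ℕ.+ 6 ℕ.* W ℕ.≤ nonroots F₂ ℕ.+ 3 ℕ.* nonroots F₃ →
  ℕ→ℚ L ≤ ((+ 3 / 1) - (+ 2 / 1) * α) * (+ 1 / 3) * (ℕ→ℚ (Nnodes F₁) - ℕ→ℚ (Kcomps F₁))
          + α * (+ 1 / 6) * (ℕ→ℚ (Nnodes F₂) - ℕ→ℚ (Kcomps F₂))
          + α * (+ 1 / 2) * (ℕ→ℚ (Nnodes F₃) - ℕ→ℚ (Kcomps F₃))
          + 1ℚ
branchings-leaf-bound α 1≤α {F₁ = F₁} {F₂} {F₃} {L} W′ W branching₁ branching₂ branching₃ L≤ W′≤ A≤B = begin
  ℕ→ℚ L                                             ≤⟨ weighted-bound α 1≤α W m₁ m₂ m₃ L≤ W′≤ A≤B ⟩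
  c₁ * ℕ→ℚ m₁ + c₂ * ℕ→ℚ m₂ + c₃ * ℕ→ℚ m₃ + 1ℚ
    ≡⟨ cong₂ (λ x y → c₁ * x + c₂ * y + c₃ * ℕ→ℚ m₃ + 1ℚ) (arcs branching₁) (arcs branching₂) ⟨
  c₁ * d₁ + c₂ * d₂ + c₃ * ℕ→ℚ m₃ + 1ℚ              ≡⟨ cong (λ z → c₁ * d₁ + c₂ * d₂ + c₃ * z + 1ℚ) (arcs branching₃) ⟨
  c₁ * d₁ + c₂ * d₂ + c₃ * d₃ + 1ℚ                  ∎
  where
  open ≤-Reasoning
  c₁ = ((+ 3 / 1) - (+ 2 / 1) * α) * (+ 1 / 3)
  c₂ = α * (+ 1 / 6)
  c₃ = α * (+ 1 / 2)
  m₁ = nonroots F₁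
  m₂ = nonroots F₂
  m₃ = nonroots F₃
  d₁ = ℕ→ℚ (Nnodes F₁) - ℕ→ℚ (Kcomps F₁)
  d₂ = ℕ→ℚ (Nnodes F₂) - ℕ→ℚ (Kcomps F₂)
  d₃ = ℕ→ℚ (Nnodes F₃) - ℕ→ℚ (Kcomps F₃)
  arcs : ∀ {F : Digraph _} → IsBranching F → ℕ→ℚ (Nnodes F) - ℕ→ℚ (Kcomps F) ≡ ℕ→ℚ (nonroots F)
  arcs {F} branching = ℕ→ℚ-difference {Nnodes F} {Kcomps F} {nonroots F} (Branching.Nnodes≡Kcomps+nonroots branching)

lemma9 : ∀ (n : ℕ) (D : Digraph n) → IsDag D → IsRooted D →
  (α : ℚ) → 1ℚ ≤ α →
  (order : List (Fin n)) → order ↭ allFin n →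
  let F₁ = GreedyExpand D 4 F₀ order
      cs = Candidates D F₁
  in (I : VSubset cs) → Independent cs I →
  (∀ (J : VSubset cs) → Independent cs J →
     ℕ→ℚ (totalWeight cs J) ≤ α * ℕ→ℚ (totalWeight cs I)) →
  let F₂ = addArcs cs F₁ I (λ x → weight cs x ≡ᵇ 2)
      F₃ = addArcs cs F₁ I (λ _ → true)
  in ∀ (T : Digraph n) → IsSpanningArborescenceOf D T →
     ℕ→ℚ (leaves T) ≤
       ((+ 3 / 1) - (+ 2 / 1) * α) * (+ 1 / 3)
           * (ℕ→ℚ (Nnodes F₁) - ℕ→ℚ (Kcomps F₁))
       + α * (+ 1 / 6) * (ℕ→ℚ (Nnodes F₂) - ℕ→ℚ (Kcomps F₂))
       + α * (+ 1 / 2) * (ℕ→ℚ (Nnodes F₃) - ℕ→ℚ (Kcomps F₃))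
       + 1ℚ
lemma9 n D dag _ α 1≤α order perm I I-independent I-approximates T T-spanning =
  branchings-leaf-bound α 1≤α
    (totalWeight (Candidates D (GreedyExpand D 4 F₀ order)) Chosen)
    (totalWeight (Candidates D (GreedyExpand D 4 F₀ order)) I)
    (GreedyExpand-branching dag order) F₂.Fₛ-branching F₃.Fₛ-branching
    leaves≤nonroots+1+weight
    (I-approximates Chosen chosen-independent)
    nonroots-bound
  where
  open Greedy D 4
  open Invariant (GreedyExpand-invariant order F₀ F₀-invariant)
  open AddArcs dag ⊆D indeg≤1 I I-independent
  open LeafBound dag T-spanning successors-covered
    (λ v out → ℕ.s≤s⁻¹ (GreedyExpand-settled (ℕ.s≤s ℕ.z≤n) perm v out))
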